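{- Let $T$ be a tree of diameter $d\ge 2$ with $n$ vertices. If $d=2\ell$ for an integer $\ell$, then $W(T)\le (n-1)\,g_\ell(n)$. If $d=2\ell+1$ for an integer $\ell$, then $W(T)\le (n-2)\,g_\ell(n)+\frac{n^2}{4}$.
   Context: The Wiener index $W(T)$ is the sum of distances over all unordered pairs of distinct vertices. The functions $g_k$ ($k\ge1$) are defined by $g_1(n)=n-1$ and $g_k(n)=n+g_{k-1}(n)-2\sqrt{g_{k-1}(n)}$ for $k>1$. -}

module Defs where

open import Data.Bool using (Bool; T)
open import Data.Nat as ℕ using (ℕ; zero; suc)
open import Data.Integer using (+_)
open import Data.Rational using (ℚ; _≤_; _+_; _*_; _-_; _/_; 1ℚ; Positive)
open import Data.Fin using (Fin)
open import Data.Fin.Properties using (_<?_)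
open import Data.Nat.ListAction using (sum)
open import Data.List using (List; []; _∷_; _∷ʳ_; length; map; concatMap; filter; allFin)
open import Data.List.Relation.Unary.Linked using (Linked)
open import Data.List.Relation.Unary.Unique.Propositional using (Unique)
open import Data.Product using (Σ; ∃; _×_; _,_)
open import Data.Empty using (⊥)
open import Relation.Nullary using (¬_)
open import Relation.Binary.PropositionalEquality using (_≡_)

record Graph (n : ℕ) : Set where
  field
    adj     : Fin n → Fin n → Bool
    adj-sym : ∀ u v → adj u v ≡ adj v u
    adj-irr : ∀ u → ¬ T (adj u u)

module _ {n : ℕ} (G : Graph n) where
  open Graph G

  Adj : Fin n → Fin n → Set
  Adj u v = T (adj u v)

  data Walk : Fin n → Fin n → ℕ → Set where
    nil  : ∀ {u} → Walk u u 0
    cons : ∀ {u w v k} → Adj u w → Walk w v k → Walk u v (suc k)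

  Connected : Set
  Connected = ∀ u v → ∃ λ k → Walk u v k

  -- a cycle: distinct vertices x, x₁, …, x_m (m ≥ 2, so ≥ 3 vertices),
  -- consecutive ones adjacent, and x_m adjacent to x
  HasCycle : Set
  HasCycle = Σ (Fin n) λ x → Σ (List (Fin n)) λ xs →
    (2 ℕ.≤ length xs) × Unique (x ∷ xs) × Linked Adj ((x ∷ xs) ∷ʳ x)

  IsTree : Set
  IsTree = Connected × ¬ HasCycle

  IsDistance : Fin n → Fin n → ℕ → Set
  IsDistance u v k = Walk u v k × (∀ m → Walk u v m → k ℕ.≤ m)

-- Wiener index of a distance function: sum over unordered pairs {u,v}, u ≠ v
wiener : {n : ℕ} → (Fin n → Fin n → ℕ) → ℕ
wiener {n} dist =
  sum (concatMap (λ u → map (λ v → dist u v) (filter (u <?_) (allFin n))) (allFin n))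

IsDiameter : {n : ℕ} → (Fin n → Fin n → ℕ) → ℕ → Set
IsDiameter {n} dist d = (∃ λ u → ∃ λ v → dist u v ≡ d) × (∀ u v → dist u v ℕ.≤ d)

-- The real numbers g_k(n) (g_1(n) = n-1, g_k(n) = n + g_{k-1}(n) - 2√g_{k-1}(n))
-- are handled through their lower Dedekind cuts in ℚ.

ℕ→ℚ : ℕ → ℚ
ℕ→ℚ m = + m / 1

-- LeG k n y  ⇔  y ≤ g_k(n)   (for n ≥ 2, k ≥ 1; g_0 is undefined)
-- Since g_{k-1}(n) ≥ 1 and x ↦ (√x - 1)² + n - 1 = n + x - 2√x is increasing on
-- [1,∞), g_k(n) = sup { (u-1)² + n - 1 : u ∈ ℚ, 1 ≤ u, u² ≤ g_{k-1}(n) }.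
LeG : ℕ → ℕ → ℚ → Set
LeG zero          n y = ⊥
LeG (suc zero)    n y = y ≤ ℕ→ℚ n - 1ℚ
LeG (suc (suc k)) n y = ∀ (ε : ℚ) → Positive ε → ∃ λ u →
  (1ℚ ≤ u) × LeG (suc k) n (u * u) ×
  (y ≤ (u - 1ℚ) * (u - 1ℚ) + (ℕ→ℚ n - 1ℚ) + ε)

-- x ≤ a · g_k(n) + b   (for a ≥ 0)
LeAffG : ℚ → ℚ → ℕ → ℕ → ℚ → Set
LeAffG a b k n x = ∀ (ε : ℚ) → Positive ε → ∃ λ y → LeG k n y × (x ≤ a * y + b + ε)

{-# OPTIONS --safe #-}
-- Root the tree at a central vertex c (d = 2ℓ), or at the central edge c₁c₂ with c₁ as
-- root (d = 2ℓ + 1), and give every vertex its level: its distance to the center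
-- {c} resp. {c₁, c₂}, which is at most ℓ.  In a rooted tree the distance of u and w is
-- the number of vertices that are ancestors of exactly one of them, so
-- W(T) = Σ_z s_z (n - s_z) with s_z the size of the subtree at z.  For z of level i ≥ 1,
-- AM-GM gives s (n - s) ≤ s g_{ℓ+1-i} - (s - 1) g_{ℓ-i}  (g₀ = 0), and summed over all
-- vertices off the center this telescopes along root paths to (n - 1) g_ℓ resp.
-- (n - 2) g_ℓ; in the odd case the subtree at c₂ adds s (n - s) ≤ n²/4.  As g_k is
-- irrational, the argument is run with integer lower approximations of D² g_k built from
-- integer square roots, whose rounding errors contribute O(1/D).
module Submission where

open import Data.Bool using (Bool; true; false; T; if_then_else_; not; _∨_; _xor_)
open import Data.Bool.Properties using (∨-idem; ∨-zeroʳ; xor-same; xor-comm)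
open import Data.Empty using (⊥; ⊥-elim)
open import Data.Fin using (Fin; zero; suc)
open import Data.Fin.Properties using (_<?_) renaming (_≟_ to _≟ᶠ_; suc-injective to Fin-suc-injective)
open import Data.List using (List; []; _∷_; _∷ʳ_; length; map; concatMap; filter; allFin; tabulate)
open import Data.List.Relation.Unary.All as All using (All; []; _∷_)
open import Data.List.Relation.Unary.All.Properties using (∷ʳ⁺)
open import Data.List.Relation.Unary.AllPairs using ([]; _∷_)
open import Data.List.Relation.Unary.Linked using (Linked; []; [-]; _∷_)
open import Data.List.Relation.Unary.Unique.Propositional using (Unique)
open import Data.Product using (∃; _×_; _,_; proj₁; proj₂)
open import Data.Sum using (_⊎_; inj₁; inj₂)
open import Function using (_∘_; id; case_of_)
import Induction.WellFounded as WF
open import Relation.Binary.Construct.On as On using ()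
open import Relation.Binary.Definitions using (tri<; tri≈; tri>)
open import Relation.Binary.PropositionalEquality
open import Relation.Nullary using (Dec; yes; no; does; ¬_)
open import Relation.Nullary.Decidable using (dec-true; dec-false)
open import Defs

module RationalBounds where
  open import Data.Nat as ℕ using (ℕ; zero; suc)
  import Data.Nat.Properties as ℕ
  import Data.Nat.Tactic.RingSolver as ℕ-Solver
  open import Data.Integer as ℤ using (+_)
  import Data.Integer.Properties as ℤ
  import Data.Integer.Tactic.RingSolver as ℤ-Solver
  open import Data.Rational
  open import Data.Rational.Properties
  open import Data.Rational.Unnormalised as ℚᵘ using (ℚᵘ; mkℚᵘ; *≡*; *≤*)
  import Data.Rational.Unnormalised.Properties as ℚᵘ
  open import Data.Rational.Solver using (module +-*-Solver)
  open +-*-Solver using (solve; _:+_; _:*_; _:-_; _:=_; con)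

  toℚᵘ-ℕ→ℚ : ∀ m → toℚᵘ (ℕ→ℚ m) ℚᵘ.≃ mkℚᵘ (+ m) 0
  toℚᵘ-ℕ→ℚ m = toℚᵘ-fromℚᵘ (mkℚᵘ (+ m) 0)

  ℕ→ℚ-+ : ∀ a b → ℕ→ℚ (a ℕ.+ b) ≡ ℕ→ℚ a + ℕ→ℚ b
  ℕ→ℚ-+ a b = toℚᵘ-injective (ℚᵘ.≃-trans (toℚᵘ-ℕ→ℚ (a ℕ.+ b)) (ℚᵘ.≃-trans eq
    (ℚᵘ.≃-sym (ℚᵘ.≃-trans (toℚᵘ-homo-+ (ℕ→ℚ a) (ℕ→ℚ b)) (ℚᵘ.+-cong (toℚᵘ-ℕ→ℚ a) (toℚᵘ-ℕ→ℚ b))))))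
    where
    eq : mkℚᵘ (+ (a ℕ.+ b)) 0 ℚᵘ.≃ mkℚᵘ (+ a) 0 ℚᵘ.+ mkℚᵘ (+ b) 0
    eq = *≡* (trans (cong (ℤ._* + 1) (ℤ.pos-+ a b)) (expand (+ a) (+ b)))
      where
      expand : ∀ x y → (x ℤ.+ y) ℤ.* + 1 ≡ (x ℤ.* + 1 ℤ.+ y ℤ.* + 1) ℤ.* + 1
      expand = ℤ-Solver.solve-∀

  ℕ→ℚ-* : ∀ a b → ℕ→ℚ (a ℕ.* b) ≡ ℕ→ℚ a * ℕ→ℚ b
  ℕ→ℚ-* a b = toℚᵘ-injective (ℚᵘ.≃-trans (toℚᵘ-ℕ→ℚ (a ℕ.* b)) (ℚᵘ.≃-trans eq
    (ℚᵘ.≃-sym (ℚᵘ.≃-trans (toℚᵘ-homo-* (ℕ→ℚ a) (ℕ→ℚ b)) (ℚᵘ.*-cong (toℚᵘ-ℕ→ℚ a) (toℚᵘ-ℕ→ℚ b))))))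
    where
    eq : mkℚᵘ (+ (a ℕ.* b)) 0 ℚᵘ.≃ mkℚᵘ (+ a) 0 ℚᵘ.* mkℚᵘ (+ b) 0
    eq = *≡* (cong (ℤ._* + 1) (ℤ.pos-* a b))

  ℕ→ℚ-*³ : ∀ a b c → ℕ→ℚ (a ℕ.* b ℕ.* c) ≡ ℕ→ℚ a * ℕ→ℚ b * ℕ→ℚ c
  ℕ→ℚ-*³ a b c = trans (ℕ→ℚ-* (a ℕ.* b) c) (cong (_* ℕ→ℚ c) (ℕ→ℚ-* a b))

  toℚᵘ-cancel-≤′ : ∀ {p q x y} → toℚᵘ p ℚᵘ.≃ x → toℚᵘ q ℚᵘ.≃ y → x ℚᵘ.≤ y → p ≤ q
  toℚᵘ-cancel-≤′ p≃x q≃y x≤y = toℚᵘ-cancel-≤ (ℚᵘ.≤-respˡ-≃ (ℚᵘ.≃-sym p≃x) (ℚᵘ.≤-respʳ-≃ (ℚᵘ.≃-sym q≃y) x≤y))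

  ℕ→ℚ-mono-≤ : ∀ {a b} → a ℕ.≤ b → ℕ→ℚ a ≤ ℕ→ℚ b
  ℕ→ℚ-mono-≤ {a} {b} a≤b = toℚᵘ-cancel-≤′ (toℚᵘ-ℕ→ℚ a) (toℚᵘ-ℕ→ℚ b)
    (*≤* (subst₂ ℤ._≤_ (sym (ℤ.*-identityʳ (+ a))) (sym (ℤ.*-identityʳ (+ b))) (ℤ.+≤+ a≤b)))

  ℕ→ℚ-∸ : ∀ {a b} → b ℕ.≤ a → ℕ→ℚ (a ℕ.∸ b) ≡ ℕ→ℚ a - ℕ→ℚ b
  ℕ→ℚ-∸ {a} {b} b≤a = begin
    ℕ→ℚ (a ℕ.∸ b)                   ≡⟨ cancel (ℕ→ℚ (a ℕ.∸ b)) (ℕ→ℚ b) ⟨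
    ℕ→ℚ (a ℕ.∸ b) + ℕ→ℚ b - ℕ→ℚ b  ≡⟨ cong (_- ℕ→ℚ b) (trans (sym (ℕ→ℚ-+ (a ℕ.∸ b) b)) (cong ℕ→ℚ (ℕ.m∸n+n≡m b≤a))) ⟩
    ℕ→ℚ a - ℕ→ℚ b                   ∎
    where
    open ≡-Reasoning
    cancel : ∀ x y → x + y - y ≡ x
    cancel = solve 2 (λ x y → x :+ y :- y := x) refl

  ℕ→ℚ-nonNeg : ∀ m → NonNegative (ℕ→ℚ m)
  ℕ→ℚ-nonNeg m = normalize-nonNeg m 1

  1/suc : ℕ → ℚ
  1/suc k = + 1 / suc k

  1/suc-nonNeg : ∀ k → NonNegative (1/suc k)
  1/suc-nonNeg k = normalize-nonNeg 1 (suc k)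

  ℕ→ℚ-*-1/suc : ∀ k → ℕ→ℚ (suc k) * 1/suc k ≡ 1ℚ
  ℕ→ℚ-*-1/suc k = toℚᵘ-injective (ℚᵘ.≃-trans (toℚᵘ-homo-* (ℕ→ℚ (suc k)) (1/suc k))
    (ℚᵘ.≃-trans (ℚᵘ.*-cong (toℚᵘ-ℕ→ℚ (suc k)) (toℚᵘ-fromℚᵘ (mkℚᵘ (+ 1) k))) (ℚᵘ.≃-trans eq (ℚᵘ.≃-sym (toℚᵘ-ℕ→ℚ 1)))))
    where
    eq : mkℚᵘ (+ suc k) 0 ℚᵘ.* mkℚᵘ (+ 1) k ℚᵘ.≃ mkℚᵘ (+ 1) 0
    eq = *≡* (cong (λ m → + suc m) (expand k))
      where
      expand : ∀ k → k ℕ.* 1 ℕ.* 1 ≡ k ℕ.+ 0 ℕ.* suc k ℕ.+ 0 ℕ.* suc (k ℕ.+ 0 ℕ.* suc k)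
      expand = ℕ-Solver.solve-∀

  ¼ : ℚ
  ¼ = 1/suc 3

  4*¼≡1 : ℕ→ℚ 4 * ¼ ≡ 1ℚ
  4*¼≡1 = ℕ→ℚ-*-1/suc 3

  /4≡*¼ : ∀ m → (+ m) / 4 ≡ ℕ→ℚ m * ¼
  /4≡*¼ m = toℚᵘ-injective (ℚᵘ.≃-trans (toℚᵘ-fromℚᵘ (mkℚᵘ (+ m) 3)) (ℚᵘ.≃-trans eq
    (ℚᵘ.≃-sym (ℚᵘ.≃-trans (toℚᵘ-homo-* (ℕ→ℚ m) (1/suc 3)) (ℚᵘ.*-cong (toℚᵘ-ℕ→ℚ m) (toℚᵘ-fromℚᵘ (mkℚᵘ (+ 1) 3)))))))
    where
    eq : mkℚᵘ (+ m) 3 ℚᵘ.≃ mkℚᵘ (+ m) 0 ℚᵘ.* mkℚᵘ (+ 1) 3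
    eq = *≡* (cong (ℤ._* + 4) (sym (ℤ.*-identityʳ (+ m))))

  -- ε * ↧ε is the numerator of ε
  1≤ε*↧ε : ∀ ε → Positive ε → 1ℚ ≤ ε * ℕ→ℚ (↧ₙ ε)
  1≤ε*↧ε (mkℚ (+ suc p) q c) _ = toℚᵘ-cancel-≤′ (toℚᵘ-ℕ→ℚ 1)
    (ℚᵘ.≃-trans (toℚᵘ-homo-* (mkℚ (+ suc p) q c) (ℕ→ℚ (suc q))) (ℚᵘ.*-cong (ℚᵘ.≃-refl {mkℚᵘ (+ suc p) q}) (toℚᵘ-ℕ→ℚ (suc q))))
    (*≤* (subst₂ ℤ._≤_ (sym lhs) (sym rhs) (ℤ.+≤+ (ℕ.*-monoˡ-≤ (suc q) {1} {suc p} (ℕ.s≤s ℕ.z≤n)))))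
    where
    lhs : + 1 ℤ.* ℚᵘ.denominator (mkℚᵘ (+ suc p) q ℚᵘ.* mkℚᵘ (+ suc q) 0) ≡ + (1 ℕ.* suc q)
    lhs = cong (λ m → + suc m) (trans (ℕ.+-identityʳ (q ℕ.* 1)) (trans (ℕ.*-identityʳ q) (sym (ℕ.+-identityʳ q))))
    rhs : ℚᵘ.numerator (mkℚᵘ (+ suc p) q ℚᵘ.* mkℚᵘ (+ suc q) 0) ℤ.* ℚᵘ.denominator (mkℚᵘ (+ 1) 0) ≡ + (suc p ℕ.* suc q)
    rhs = cong (λ m → + suc m) (ℕ.*-identityʳ (q ℕ.+ p ℕ.* suc q))

  LeG-mono : ∀ k n {y y′} → LeG k n y → y′ ≤ y → LeG k n y′
  LeG-mono (suc zero)    n y≤ y′≤y = ≤-trans y′≤y y≤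
  LeG-mono (suc (suc k)) n le y′≤y ε ε>0 with le ε ε>0
  ... | u , 1≤u , u²≤ , y≤ = u , 1≤u , u²≤ , ≤-trans y′≤y y≤

  module Rescaled (k : ℕ) where

    D : ℕ
    D = suc k

    v : ℚ
    v = 1/suc k

    infix 9 _/D²
    _/D² : ℕ → ℚ
    m /D² = ℕ→ℚ m * (v * v)

    instance
      v-nonNeg : NonNegative v
      v-nonNeg = 1/suc-nonNeg k
      v²-nonNeg : NonNegative (v * v)
      v²-nonNeg = nonNeg*nonNeg⇒nonNeg v v
      ¼v²-nonNeg : NonNegative (¼ * (v * v))
      ¼v²-nonNeg = nonNeg*nonNeg⇒nonNeg ¼ {{1/suc-nonNeg 3}} (v * v)

    Dv≡1 : ℕ→ℚ D * v ≡ 1ℚ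
    Dv≡1 = ℕ→ℚ-*-1/suc k

    D²m/D² : ∀ m → (D ℕ.* D ℕ.* m) /D² ≡ ℕ→ℚ m
    D²m/D² m = begin
      ℕ→ℚ (D ℕ.* D ℕ.* m) * (v * v)       ≡⟨ cong (_* (v * v)) (ℕ→ℚ-*³ D D m) ⟩
      ℕ→ℚ D * ℕ→ℚ D * ℕ→ℚ m * (v * v)     ≡⟨ regroup (ℕ→ℚ D) v (ℕ→ℚ m) ⟩
      (ℕ→ℚ D * v) * (ℕ→ℚ D * v) * ℕ→ℚ m   ≡⟨ cong (λ x → x * x * ℕ→ℚ m) Dv≡1 ⟩
      1ℚ * 1ℚ * ℕ→ℚ m                      ≡⟨ trans (cong (_* ℕ→ℚ m) (*-identityˡ 1ℚ)) (*-identityˡ _) ⟩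
      ℕ→ℚ m                                ∎
      where
      open ≡-Reasoning
      regroup : ∀ d v m → d * d * m * (v * v) ≡ (d * v) * (d * v) * m
      regroup = solve 3 (λ d v m → d :* d :* m :* (v :* v) := (d :* v) :* (d :* v) :* m) refl

    LeG-base : ∀ {n} → 1 ℕ.≤ n → LeG 1 n ((D ℕ.* D ℕ.* (n ℕ.∸ 1)) /D²)
    LeG-base {n} 1≤n = ≤-reflexive (trans (D²m/D² (n ℕ.∸ 1)) (ℕ→ℚ-∸ 1≤n))

    -- one step of g ↦ (√g - 1)² + n - 1, with √g approximated from below by a / D
    LeG-step : ∀ {j n a H} → 1 ℕ.≤ n → D ℕ.≤ a → a ℕ.* a ℕ.≤ H → LeG (suc j) n (H /D²) →
               LeG (suc (suc j)) n (((a ℕ.∸ D) ℕ.* (a ℕ.∸ D) ℕ.+ D ℕ.* D ℕ.* (n ℕ.∸ 1)) /D²)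
    LeG-step {j} {n} {a} {H} 1≤n D≤a a²≤H H/D² ε ε>0 =
      ℕ→ℚ a * v , 1≤u , LeG-mono (suc j) n H/D² u²≤H/D² , ≤-trans (≤-reflexive rescaled) y≤y+ε
      where
      1≤u : 1ℚ ≤ ℕ→ℚ a * v
      1≤u = ≤-trans (≤-reflexive (sym Dv≡1)) (*-monoʳ-≤-nonNeg v (ℕ→ℚ-mono-≤ D≤a))
      u²≤H/D² : ℕ→ℚ a * v * (ℕ→ℚ a * v) ≤ H /D²
      u²≤H/D² = ≤-trans (≤-reflexive (trans (regroup (ℕ→ℚ a) v) (cong (_* (v * v)) (sym (ℕ→ℚ-* a a)))))
                        (*-monoʳ-≤-nonNeg (v * v) (ℕ→ℚ-mono-≤ a²≤H))
        where
        regroup : ∀ a v → (a * v) * (a * v) ≡ a * a * (v * v)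
        regroup = solve 2 (λ a v → (a :* v) :* (a :* v) := a :* a :* (v :* v)) refl
      rescaled : ((a ℕ.∸ D) ℕ.* (a ℕ.∸ D) ℕ.+ D ℕ.* D ℕ.* (n ℕ.∸ 1)) /D²
                 ≡ (ℕ→ℚ a * v - 1ℚ) * (ℕ→ℚ a * v - 1ℚ) + (ℕ→ℚ n - 1ℚ)
      rescaled = begin
        ℕ→ℚ ((a ℕ.∸ D) ℕ.* (a ℕ.∸ D) ℕ.+ D ℕ.* D ℕ.* (n ℕ.∸ 1)) * (v * v)
          ≡⟨ cong (_* (v * v)) (trans (ℕ→ℚ-+ ((a ℕ.∸ D) ℕ.* (a ℕ.∸ D)) (D ℕ.* D ℕ.* (n ℕ.∸ 1)))
               (cong (_+ ℕ→ℚ (D ℕ.* D ℕ.* (n ℕ.∸ 1))) (trans (ℕ→ℚ-* (a ℕ.∸ D) (a ℕ.∸ D)) (cong (λ x → x * x) (ℕ→ℚ-∸ D≤a))))) ⟩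
        ((ℕ→ℚ a - ℕ→ℚ D) * (ℕ→ℚ a - ℕ→ℚ D) + ℕ→ℚ (D ℕ.* D ℕ.* (n ℕ.∸ 1))) * (v * v)
          ≡⟨ distrib (ℕ→ℚ a) (ℕ→ℚ D) v (ℕ→ℚ (D ℕ.* D ℕ.* (n ℕ.∸ 1))) ⟩
        (ℕ→ℚ a * v - ℕ→ℚ D * v) * (ℕ→ℚ a * v - ℕ→ℚ D * v) + (D ℕ.* D ℕ.* (n ℕ.∸ 1)) /D²
          ≡⟨ cong₂ (λ x y → (ℕ→ℚ a * v - x) * (ℕ→ℚ a * v - x) + y) Dv≡1 (trans (D²m/D² (n ℕ.∸ 1)) (ℕ→ℚ-∸ 1≤n)) ⟩
        (ℕ→ℚ a * v - 1ℚ) * (ℕ→ℚ a * v - 1ℚ) + (ℕ→ℚ n - 1ℚ) ∎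
        where
        open ≡-Reasoning
        distrib : ∀ a d v m → ((a - d) * (a - d) + m) * (v * v) ≡ (a * v - d * v) * (a * v - d * v) + m * (v * v)
        distrib = solve 4 (λ a d v m → ((a :- d) :* (a :- d) :+ m) :* (v :* v)
                                     := (a :* v :- d :* v) :* (a :* v :- d :* v) :+ m :* (v :* v)) refl
      y≤y+ε : ∀ {y} → y ≤ y + ε
      y≤y+ε {y} = ≤-trans (≤-reflexive (sym (+-identityʳ y))) (+-monoʳ-≤ y (nonNegative⁻¹ ε {{pos⇒nonNeg ε {{ε>0}}}}))

    Cv≤ε : ∀ C ε → Positive ε → C ℕ.* ↧ₙ ε ℕ.≤ D → ℕ→ℚ C * v ≤ ε
    Cv≤ε C ε ε>0 C↧ε≤D = begin
      ℕ→ℚ C * v      ≤⟨ *-monoʳ-≤-nonNeg v C≤εD ⟩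
      ε * ℕ→ℚ D * v  ≡⟨ trans (*-assoc ε (ℕ→ℚ D) v) (cong (ε *_) Dv≡1) ⟩
      ε * 1ℚ         ≡⟨ *-identityʳ ε ⟩
      ε              ∎
      where
      open ≤-Reasoning
      instance
        _ = pos⇒nonNeg ε {{ε>0}}
        _ = ℕ→ℚ-nonNeg C
      C≤εD : ℕ→ℚ C ≤ ε * ℕ→ℚ D
      C≤εD = begin
        ℕ→ℚ C                   ≡⟨ *-identityˡ (ℕ→ℚ C) ⟨
        1ℚ * ℕ→ℚ C              ≤⟨ *-monoʳ-≤-nonNeg (ℕ→ℚ C) (1≤ε*↧ε ε ε>0) ⟩
        ε * ℕ→ℚ (↧ₙ ε) * ℕ→ℚ C  ≡⟨ trans (*-assoc ε _ _) (cong (ε *_) (trans (*-comm _ (ℕ→ℚ C)) (sym (ℕ→ℚ-* C (↧ₙ ε))))) ⟩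
        ε * ℕ→ℚ (C ℕ.* ↧ₙ ε)    ≤⟨ *-monoˡ-≤-nonNeg ε (ℕ→ℚ-mono-≤ C↧ε≤D) ⟩
        ε * ℕ→ℚ D               ∎

    ⌜_⌝ : ℕ → ℚ
    ⌜_⌝ = ℕ→ℚ

    4D²W/4D² : ∀ W → ⌜ 4 ℕ.* (D ℕ.* D ℕ.* W) ⌝ * (¼ * (v * v)) ≡ ⌜ W ⌝
    4D²W/4D² W = begin
      ⌜ 4 ℕ.* (D ℕ.* D ℕ.* W) ⌝ * (¼ * (v * v))
        ≡⟨ cong (_* (¼ * (v * v))) (trans (ℕ→ℚ-* 4 (D ℕ.* D ℕ.* W)) (cong (⌜ 4 ⌝ *_) (ℕ→ℚ-*³ D D W))) ⟩
      ⌜ 4 ⌝ * (⌜ D ⌝ * ⌜ D ⌝ * ⌜ W ⌝) * (¼ * (v * v))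
        ≡⟨ regroup ⌜ 4 ⌝ ¼ ⌜ D ⌝ v ⌜ W ⌝ ⟩
      (⌜ 4 ⌝ * ¼) * ((⌜ D ⌝ * v) * (⌜ D ⌝ * v)) * ⌜ W ⌝
        ≡⟨ cong₂ (λ x y → x * (y * y) * ⌜ W ⌝) 4*¼≡1 Dv≡1 ⟩
      1ℚ * (1ℚ * 1ℚ) * ⌜ W ⌝
        ≡⟨ unit³ ⌜ W ⌝ ⟩
      ⌜ W ⌝ ∎
      where
      open ≡-Reasoning
      regroup : ∀ f i d v w → f * (d * d * w) * (i * (v * v)) ≡ (f * i) * ((d * v) * (d * v)) * w
      regroup = solve 5 (λ f i d v w → f :* (d :* d :* w) :* (i :* (v :* v)) := (f :* i) :* ((d :* v) :* (d :* v)) :* w) refl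
      unit³ : ∀ w → 1ℚ * (1ℚ * 1ℚ) * w ≡ w
      unit³ = solve 1 (λ w → con 1ℚ :* (con 1ℚ :* con 1ℚ) :* w := w) refl

    [4CD+4mH+D²q]/4D² : ∀ C m H q → ⌜ 4 ℕ.* (C ℕ.* D) ℕ.+ 4 ℕ.* (m ℕ.* H) ℕ.+ D ℕ.* D ℕ.* q ⌝ * (¼ * (v * v))
                                     ≡ ⌜ m ⌝ * H /D² + (+ q) / 4 + ⌜ C ⌝ * v
    [4CD+4mH+D²q]/4D² C m H q = begin
      ⌜ 4 ℕ.* (C ℕ.* D) ℕ.+ 4 ℕ.* (m ℕ.* H) ℕ.+ D ℕ.* D ℕ.* q ⌝ * (¼ * (v * v))
        ≡⟨ cong (_* (¼ * (v * v))) homo ⟩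
      (⌜ 4 ⌝ * (⌜ C ⌝ * ⌜ D ⌝) + ⌜ 4 ⌝ * (⌜ m ⌝ * ⌜ H ⌝) + ⌜ D ⌝ * ⌜ D ⌝ * ⌜ q ⌝) * (¼ * (v * v))
        ≡⟨ regroup ⌜ 4 ⌝ ¼ ⌜ D ⌝ v ⌜ C ⌝ ⌜ m ⌝ ⌜ H ⌝ ⌜ q ⌝ ⟩
      (⌜ 4 ⌝ * ¼) * (⌜ C ⌝ * v) * (⌜ D ⌝ * v) + (⌜ 4 ⌝ * ¼) * (⌜ m ⌝ * H /D²) + (⌜ D ⌝ * v) * (⌜ D ⌝ * v) * (⌜ q ⌝ * ¼)
        ≡⟨ cong₂ (λ x y → x * (⌜ C ⌝ * v) * y + x * (⌜ m ⌝ * H /D²) + y * y * (⌜ q ⌝ * ¼)) 4*¼≡1 Dv≡1 ⟩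
      1ℚ * (⌜ C ⌝ * v) * 1ℚ + 1ℚ * (⌜ m ⌝ * H /D²) + 1ℚ * 1ℚ * (⌜ q ⌝ * ¼)
        ≡⟨ drop-units (⌜ C ⌝ * v) (⌜ m ⌝ * H /D²) (⌜ q ⌝ * ¼) ⟩
      ⌜ m ⌝ * H /D² + ⌜ q ⌝ * ¼ + ⌜ C ⌝ * v
        ≡⟨ cong (λ x → ⌜ m ⌝ * H /D² + x + ⌜ C ⌝ * v) (/4≡*¼ q) ⟨
      ⌜ m ⌝ * H /D² + (+ q) / 4 + ⌜ C ⌝ * v ∎
      where
      open ≡-Reasoning
      homo : ⌜ 4 ℕ.* (C ℕ.* D) ℕ.+ 4 ℕ.* (m ℕ.* H) ℕ.+ D ℕ.* D ℕ.* q ⌝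
             ≡ ⌜ 4 ⌝ * (⌜ C ⌝ * ⌜ D ⌝) + ⌜ 4 ⌝ * (⌜ m ⌝ * ⌜ H ⌝) + ⌜ D ⌝ * ⌜ D ⌝ * ⌜ q ⌝
      homo = trans (ℕ→ℚ-+ (4 ℕ.* (C ℕ.* D) ℕ.+ 4 ℕ.* (m ℕ.* H)) (D ℕ.* D ℕ.* q))
               (cong₂ _+_ (trans (ℕ→ℚ-+ (4 ℕ.* (C ℕ.* D)) (4 ℕ.* (m ℕ.* H)))
                            (cong₂ _+_ (trans (ℕ→ℚ-* 4 (C ℕ.* D)) (cong (⌜ 4 ⌝ *_) (ℕ→ℚ-* C D)))
                                       (trans (ℕ→ℚ-* 4 (m ℕ.* H)) (cong (⌜ 4 ⌝ *_) (ℕ→ℚ-* m H)))))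
                          (ℕ→ℚ-*³ D D q))
      regroup : ∀ f i d v c m h q → (f * (c * d) + f * (m * h) + d * d * q) * (i * (v * v))
                                  ≡ (f * i) * (c * v) * (d * v) + (f * i) * (m * (h * (v * v))) + (d * v) * (d * v) * (q * i)
      regroup = solve 8 (λ f i d v c m h q → (f :* (c :* d) :+ f :* (m :* h) :+ d :* d :* q) :* (i :* (v :* v))
                                  := (f :* i) :* (c :* v) :* (d :* v) :+ (f :* i) :* (m :* (h :* (v :* v))) :+ (d :* v) :* (d :* v) :* (q :* i)) refl
      drop-units : ∀ a b c → 1ℚ * a * 1ℚ + 1ℚ * b + 1ℚ * 1ℚ * c ≡ b + c + a
      drop-units = solve 3 (λ a b c → con 1ℚ :* a :* con 1ℚ :+ con 1ℚ :* b :+ con 1ℚ :* con 1ℚ :* c := b :+ c :+ a) refl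

    rescale : ∀ W C m H q ε → Positive ε → C ℕ.* ↧ₙ ε ℕ.≤ D →
              4 ℕ.* (D ℕ.* D ℕ.* W) ℕ.≤ 4 ℕ.* (C ℕ.* D) ℕ.+ 4 ℕ.* (m ℕ.* H) ℕ.+ D ℕ.* D ℕ.* q →
              ℕ→ℚ W ≤ ℕ→ℚ m * H /D² + (+ q) / 4 + ε
    rescale W C m H q ε ε>0 C↧ε≤D scaled = begin
      ⌜ W ⌝                                                                      ≡⟨ 4D²W/4D² W ⟨
      ⌜ 4 ℕ.* (D ℕ.* D ℕ.* W) ⌝ * (¼ * (v * v))                                 ≤⟨ *-monoʳ-≤-nonNeg (¼ * (v * v)) (ℕ→ℚ-mono-≤ scaled) ⟩
      ⌜ 4 ℕ.* (C ℕ.* D) ℕ.+ 4 ℕ.* (m ℕ.* H) ℕ.+ D ℕ.* D ℕ.* q ⌝ * (¼ * (v * v))  ≡⟨ [4CD+4mH+D²q]/4D² C m H q ⟩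
      ⌜ m ⌝ * H /D² + (+ q) / 4 + ⌜ C ⌝ * v                                      ≤⟨ +-monoʳ-≤ (⌜ m ⌝ * H /D² + (+ q) / 4) (Cv≤ε C ε ε>0 C↧ε≤D) ⟩
      ⌜ m ⌝ * H /D² + (+ q) / 4 + ε                                              ∎
      where open ≤-Reasoning
open import Data.Nat using (ℕ; zero; suc; pred; _+_; _*_; _∸_; _≤_; _<_; _≤?_; _≡ᵇ_; z≤n; s≤s; >-nonZero)
import Data.Nat.ListAction as List
open import Data.Nat.ListAction.Properties using (sum-++)
open import Data.Nat.Induction using (<-wellFounded)
open import Data.Nat.Properties hiding (_<?_)
open import Algebra.Properties.Semiring.Sum +-*-semiring
  using (sum; sum-syntax; sum-cong-≗; ∑-distrib-+; ∑-comm; *-distribˡ-sum; *-distribʳ-sum)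
open import Data.Nat.Tactic.RingSolver using (solve-∀)

⟦_⟧ : Bool → ℕ
⟦ true ⟧  = 1
⟦ false ⟧ = 0

⟦⟧≤1 : ∀ b → ⟦ b ⟧ ≤ 1
⟦⟧≤1 true  = ≤-refl
⟦⟧≤1 false = z≤n

≟-true : ∀ {n} {x y : Fin n} → does (x ≟ᶠ y) ≡ true → x ≡ y
≟-true {x = x} {y} eq with x ≟ᶠ y
≟-true eq | yes x≡y = x≡y
≟-true () | no _

distinct⇒2≤n : ∀ {n} {u v : Fin n} → u ≢ v → 2 ≤ n
distinct⇒2≤n {suc zero}    {zero} {zero} u≢v = ⊥-elim (u≢v refl)
distinct⇒2≤n {suc (suc _)} _ = s≤s (s≤s z≤n)

2*ℓ≡ℓ+ℓ : ∀ ℓ → 2 * ℓ ≡ ℓ + ℓ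
2*ℓ≡ℓ+ℓ ℓ = cong (ℓ +_) (+-identityʳ ℓ)

2*ℓ+1≡1+ℓ+ℓ : ∀ ℓ → 2 * ℓ + 1 ≡ suc ℓ + ℓ
2*ℓ+1≡1+ℓ+ℓ ℓ = trans (cong (_+ 1) (2*ℓ≡ℓ+ℓ ℓ)) (+-comm (ℓ + ℓ) 1)

sum-zero : ∀ n → ∑[ i < n ] 0 ≡ 0
sum-zero zero    = refl
sum-zero (suc n) = sum-zero n

sum-one : ∀ n → ∑[ i < n ] 1 ≡ n
sum-one zero    = refl
sum-one (suc n) = cong suc (sum-one n)

sum-mono-≤ : ∀ {n} {f g : Fin n → ℕ} → (∀ i → f i ≤ g i) → sum f ≤ sum g
sum-mono-≤ {zero}  f≤g = z≤n
sum-mono-≤ {suc n} f≤g = +-mono-≤ (f≤g zero) (sum-mono-≤ (f≤g ∘ suc))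

sum-≤-* : ∀ {n} k {f : Fin n → ℕ} → (∀ i → f i ≤ k) → sum f ≤ n * k
sum-≤-* {zero}  k f≤k = z≤n
sum-≤-* {suc n} k f≤k = +-mono-≤ (f≤k zero) (sum-≤-* k (f≤k ∘ suc))

≤-sum : ∀ {n} (f : Fin n → ℕ) i → f i ≤ sum f
≤-sum f zero    = m≤m+n _ _
≤-sum f (suc i) = ≤-trans (≤-sum (f ∘ suc) i) (m≤n+m _ (f zero))

sum-point : ∀ {n} (x : Fin n) (f : Fin n → ℕ) →
            ∑[ z < n ] (if does (z ≟ᶠ x) then f z else 0) ≡ f x
sum-point {suc n} zero    f = trans (cong (f zero +_) (sum-zero n)) (+-identityʳ _)
sum-point {suc n} (suc x) f = sum-point x (f ∘ suc)

∑-+-point : ∀ {n} (f : Fin n → ℕ) c (g : Fin n → ℕ) →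
            ∑[ z < n ] (f z + (if does (z ≟ᶠ c) then g z else 0)) ≡ sum f + g c
∑-+-point f c g = trans (∑-distrib-+ f _) (cong (sum f +_) (sum-point c g))

sum-except : ∀ {n} x (f g : Fin n → ℕ) → (∀ z → z ≢ x → f z ≡ g z) →
             sum f + g x ≡ sum g + f x
sum-except zero f g f≗g = begin
  f zero + sum (f ∘ suc) + g zero ≡⟨ cong (λ s → f zero + s + g zero) (sum-cong-≗ (λ i → f≗g (suc i) λ ())) ⟩
  f zero + sum (g ∘ suc) + g zero ≡⟨ swap (f zero) (sum (g ∘ suc)) (g zero) ⟩
  g zero + sum (g ∘ suc) + f zero ∎
  where
  open ≡-Reasoning
  swap : ∀ a b c → a + b + c ≡ c + b + a
  swap = solve-∀
sum-except (suc x) f g f≗g = begin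
  f zero + sum (f ∘ suc) + g (suc x)   ≡⟨ +-assoc (f zero) _ _ ⟩
  f zero + (sum (f ∘ suc) + g (suc x)) ≡⟨ cong₂ _+_ (f≗g zero λ ()) (sum-except x (f ∘ suc) (g ∘ suc) λ z z≢x → f≗g (suc z) (z≢x ∘ Fin-suc-injective)) ⟩
  g zero + (sum (g ∘ suc) + f (suc x)) ≡⟨ +-assoc (g zero) _ _ ⟨
  g zero + sum (g ∘ suc) + f (suc x)   ∎
  where open ≡-Reasoning

count : ∀ {n} → (Fin n → Bool) → ℕ
count {n} p = ∑[ i < n ] ⟦ p i ⟧

count+count-not : ∀ {n} (p : Fin n → Bool) → count p + count (not ∘ p) ≡ n
count+count-not {zero}  p = refl
count+count-not {suc n} p with p zero
... | true  = cong suc (count+count-not (p ∘ suc))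
... | false = trans (+-suc _ _) (cong suc (count+count-not (p ∘ suc)))

count≤n : ∀ {n} (p : Fin n → Bool) → count p ≤ n
count≤n p = subst (count p ≤_) (count+count-not p) (m≤m+n _ _)

pairSum : ∀ {n} → (Fin n → Fin n → ℕ) → ℕ
pairSum {n} F = ∑[ u < n ] ∑[ w < n ] (if does (u <? w) then F u w else 0)

wiener≡pairSum : ∀ {n} (F : Fin n → Fin n → ℕ) → wiener F ≡ pairSum F
wiener≡pairSum {n} F = begin
  wiener F
    ≡⟨ List-sum-concatMap (allFin n) ⟩
  List.sum (map (λ u → List.sum (map (F u) (filter (u <?_) (allFin n)))) (allFin n))
    ≡⟨ List-sum-tabulate {n} id _ ⟩
  ∑[ u < n ] List.sum (map (F u) (filter (u <?_) (allFin n)))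
    ≡⟨ sum-cong-≗ {n} (λ u → trans (List-sum-filter (u <?_) (F u) (allFin n)) (List-sum-tabulate {n} id _)) ⟩
  pairSum F ∎
  where
  open ≡-Reasoning
  List-sum-tabulate : ∀ {m} {A : Set} (g : Fin m → A) (f : A → ℕ) →
                      List.sum (map f (tabulate g)) ≡ sum (f ∘ g)
  List-sum-tabulate {zero}  g f = refl
  List-sum-tabulate {suc m} g f = cong (f (g zero) +_) (List-sum-tabulate (g ∘ suc) f)
  List-sum-concatMap : ∀ {A : Set} {g : A → List ℕ} xs →
                       List.sum (concatMap g xs) ≡ List.sum (map (List.sum ∘ g) xs)
  List-sum-concatMap []       = refl
  List-sum-concatMap {g = g} (x ∷ xs) = trans (sum-++ (g x) _) (cong (List.sum (g x) +_) (List-sum-concatMap xs))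
  List-sum-filter : ∀ {A : Set} {P : A → Set} (P? : ∀ x → Dec (P x)) (f : A → ℕ) xs →
                    List.sum (map f (filter P? xs)) ≡ List.sum (map (λ x → if does (P? x) then f x else 0) xs)
  List-sum-filter P? f []       = refl
  List-sum-filter P? f (x ∷ xs) with does (P? x)
  ... | true  = cong (f x +_) (List-sum-filter P? f xs)
  ... | false = List-sum-filter P? f xs

pairSum-mono-≤ : ∀ {n} {F G : Fin n → Fin n → ℕ} → (∀ u w → F u w ≤ G u w) → pairSum F ≤ pairSum G
pairSum-mono-≤ F≤G = sum-mono-≤ λ u → sum-mono-≤ λ w → if-mono (does (u <? w)) (F≤G u w)
  where
  if-mono : ∀ b {x y} → x ≤ y → (if b then x else 0) ≤ (if b then y else 0)
  if-mono true  x≤y = x≤y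
  if-mono false _   = z≤n

pairSum-∑ : ∀ {n m} (f : Fin m → Fin n → Fin n → ℕ) →
            pairSum (λ u w → ∑[ z < m ] f z u w) ≡ ∑[ z < m ] pairSum (f z)
pairSum-∑ {n} {m} f = begin
  ∑[ u < n ] ∑[ w < n ] (if does (u <? w) then ∑[ z < m ] f z u w else 0)
    ≡⟨ sum-cong-≗ {n} (λ u → sum-cong-≗ λ w → if-sum (does (u <? w)) (λ z → f z u w)) ⟩
  ∑[ u < n ] ∑[ w < n ] ∑[ z < m ] (if does (u <? w) then f z u w else 0)
    ≡⟨ sum-cong-≗ {n} (λ u → ∑-comm {n} {m} _) ⟩
  ∑[ u < n ] ∑[ z < m ] ∑[ w < n ] (if does (u <? w) then f z u w else 0)
    ≡⟨ ∑-comm {n} {m} _ ⟩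
  ∑[ z < m ] pairSum (f z) ∎
  where
  open ≡-Reasoning
  if-sum : ∀ b (g : Fin m → ℕ) → (if b then sum g else 0) ≡ ∑[ z < m ] (if b then g z else 0)
  if-sum true  g = refl
  if-sum false g = sym (sum-zero m)

pairSum-xor : ∀ {n} (p : Fin n → Bool) →
              pairSum (λ u w → ⟦ p u xor p w ⟧) ≡ count p * count (not ∘ p)
pairSum-xor {zero}  p = refl
pairSum-xor {suc n} p with p zero | pairSum-xor (p ∘ suc)
... | true  | ih = cong (count (not ∘ p ∘ suc) +_) ih
... | false | ih = trans (cong (count (p ∘ suc) +_) ih) (sym (*-suc (count (p ∘ suc)) (count (not ∘ p ∘ suc))))

1≤length-∷ʳ : ∀ {A : Set} (xs : List A) {y} → 1 ≤ length (xs ∷ʳ y)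
1≤length-∷ʳ []      = s≤s z≤n
1≤length-∷ʳ (_ ∷ _) = s≤s z≤n

unique-∷ʳ : ∀ {A : Set} {xs : List A} {y} → Unique xs → All (_≢ y) xs → Unique (xs ∷ʳ y)
unique-∷ʳ []             []           = [] ∷ []
unique-∷ʳ (x∉xs ∷ uniq) (x≢y ∷ xs≢y) = ∷ʳ⁺ x∉xs x≢y ∷ unique-∷ʳ uniq xs≢y

linked-∷ʳ : ∀ {A : Set} {R : A → A → Set} {x} xs {y z} →
            Linked R (x ∷ xs ∷ʳ y) → R y z → Linked R (x ∷ xs ∷ʳ y ∷ʳ z)
linked-∷ʳ []       (r ∷ [-]) ryz = r ∷ ryz ∷ [-]
linked-∷ʳ (_ ∷ xs) (r ∷ rs)  ryz = r ∷ linked-∷ʳ xs rs ryz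

isqrt : ∀ m → ∃ λ a → a * a ≤ m × m < suc a * suc a
isqrt zero = 0 , z≤n , s≤s z≤n
isqrt (suc m) with isqrt m
... | a , a²≤m , m<[a+1]² with suc a * suc a ≤? suc m
...   | yes [a+1]²≤1+m = suc a , [a+1]²≤1+m , ≤-trans (s≤s m<[a+1]²) (≤-trans (m≤m+n _ _) (≤-reflexive (expand a)))
  where
  expand : ∀ a → suc (suc a * suc a) + (a + a + 2) ≡ suc (suc a) * suc (suc a)
  expand = solve-∀
...   | no  [a+1]²≰1+m = a , m≤n⇒m≤1+n a²≤m , ≰⇒> [a+1]²≰1+m

⌊√_⌋ : ℕ → ℕ
⌊√ m ⌋ = proj₁ (isqrt m)

⌊√⌋²≤ : ∀ m → ⌊√ m ⌋ * ⌊√ m ⌋ ≤ m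
⌊√⌋²≤ m = proj₁ (proj₂ (isqrt m))

<[⌊√⌋+1]² : ∀ m → m < suc ⌊√ m ⌋ * suc ⌊√ m ⌋
<[⌊√⌋+1]² m = proj₂ (proj₂ (isqrt m))

*-self-cancel-≤ : ∀ {a b} → a * a ≤ b * b → a ≤ b
*-self-cancel-≤ {a} {b} a²≤b² with a ≤? b
... | yes a≤b = a≤b
... | no  a≰b = ⊥-elim (<⇒≱ (*-mono-< (≰⇒> a≰b) (≰⇒> a≰b)) a²≤b²)

2xy≤x²+y² : ∀ x y → 2 * (x * y) ≤ x * x + y * y
2xy≤x²+y² x y with ≤-total x y
... | inj₁ x≤y with m≤n⇒∃[o]m+o≡n x≤y
...   | k , refl = ≤-trans (m≤m+n _ (k * k)) (≤-reflexive (expand x k))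
  where
  expand : ∀ x k → 2 * (x * (x + k)) + k * k ≡ x * x + (x + k) * (x + k)
  expand = solve-∀
2xy≤x²+y² x y | inj₂ y≤x with m≤n⇒∃[o]m+o≡n y≤x
...   | k , refl = ≤-trans (m≤m+n _ (k * k)) (≤-reflexive (expand y k))
  where
  expand : ∀ y k → 2 * ((y + k) * y) + k * k ≡ (y + k) * (y + k) + y * y
  expand = solve-∀

4xy≤[x+y]² : ∀ x y → 4 * (x * y) ≤ (x + y) * (x + y)
4xy≤[x+y]² x y = begin
  4 * (x * y)                  ≡⟨ double (x * y) ⟩
  2 * (x * y) + 2 * (x * y)    ≤⟨ +-monoˡ-≤ (2 * (x * y)) (2xy≤x²+y² x y) ⟩
  x * x + y * y + 2 * (x * y)  ≡⟨ square x y ⟩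
  (x + y) * (x + y)            ∎
  where
  open ≤-Reasoning
  double : ∀ m → 4 * m ≡ 2 * m + 2 * m
  double = solve-∀
  square : ∀ x y → x * x + y * y + 2 * (x * y) ≡ (x + y) * (x + y)
  square = solve-∀

-- With a ≈ D √g and n = s + t this is s (n - s) + (s - 1) g ≤ s ((√g - 1)² + n - 1),
-- i.e. s² + g ≥ 2 s √g.
subtree-step : ∀ D a s t → 1 ≤ s →
               D * D * (s * t) + (s ∸ 1) * (a * a) ≤ s * ((a ∸ D) * (a ∸ D) + D * D * (s + t ∸ 1))
subtree-step D a (suc s) t _ with ≤-total a D
... | inj₁ a≤D rewrite m≤n⇒m∸n≡0 a≤D = ≤-trans (+-monoʳ-≤ _ (*-monoʳ-≤ s a²≤D²s)) (≤-reflexive (expand D s t))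
  where
  a²≤D²s : a * a ≤ D * D * suc s
  a²≤D²s = ≤-trans (*-mono-≤ a≤D a≤D) (m≤m*n (D * D) (suc s))
  expand : ∀ D s t → D * D * (suc s * t) + s * (D * D * suc s) ≡ suc s * (0 * 0 + D * D * (s + t))
  expand = solve-∀
... | inj₂ D≤a with m≤n⇒∃[o]m+o≡n D≤a
...   | b , refl rewrite m+n∸m≡n D b =
  +-cancelʳ-≤ (2 * ((D * s) * b)) _ _
    (≤-trans (+-monoʳ-≤ (D * D * (suc s * t) + s * ((D + b) * (D + b))) (2xy≤x²+y² (D * s) b))
             (≤-reflexive (expand D b s t)))
  where
  expand : ∀ D b s t → D * D * (suc s * t) + s * ((D + b) * (D + b)) + ((D * s) * (D * s) + b * b)
                     ≡ suc s * (b * b + D * D * (s + t)) + 2 * ((D * s) * b)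
  expand = solve-∀

-- h j is a lower approximation of D² g_j(n).  Setting g₀ = 0 makes the recursion
-- uniform: h 1 = D² (n - 1) because ⌊√ 0 ⌋ ∸ D = 0.
module Approximants (D n : ℕ) where

  h : ℕ → ℕ
  h zero    = 0
  h (suc j) = (⌊√ h j ⌋ ∸ D) * (⌊√ h j ⌋ ∸ D) + D * D * (n ∸ 1)

  a : ℕ → ℕ
  a j = ⌊√ h j ⌋

  h≤a²+2a : ∀ j → h j ≤ a j * a j + 2 * a j
  h≤a²+2a j = ≤-pred (≤-trans (<[⌊√⌋+1]² (h j)) (≤-reflexive (expand (a j))))
    where
    expand : ∀ a → suc a * suc a ≡ suc (a * a + 2 * a)
    expand = solve-∀

  D≤a : 1 ≤ n ∸ 1 → ∀ j → D ≤ a (suc j)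
  D≤a 1≤n-1 j = ≮⇒≥ λ a<D → <-irrefl refl (begin-strict
    h (suc j)                           <⟨ <[⌊√⌋+1]² (h (suc j)) ⟩
    suc (a (suc j)) * suc (a (suc j))  ≤⟨ *-mono-≤ a<D a<D ⟩
    D * D                               ≤⟨ m≤m*n (D * D) _ ⟩
    D * D * (n ∸ 1)                     ≤⟨ m≤n+m _ _ ⟩
    h (suc j)                           ∎)
    where
    open ≤-Reasoning
    instance _ = >-nonZero 1≤n-1

  h≤j*h₁ : ∀ j → h j ≤ j * (D * D * (n ∸ 1))
  h≤j*h₁ zero    = z≤n
  h≤j*h₁ (suc j) = begin
    (a j ∸ D) * (a j ∸ D) + D * D * (n ∸ 1)  ≤⟨ +-monoˡ-≤ _ (*-mono-≤ (m∸n≤m (a j) D) (m∸n≤m (a j) D)) ⟩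
    a j * a j + D * D * (n ∸ 1)              ≤⟨ +-monoˡ-≤ _ (≤-trans (⌊√⌋²≤ (h j)) (h≤j*h₁ j)) ⟩
    j * (D * D * (n ∸ 1)) + D * D * (n ∸ 1)  ≡⟨ +-comm _ (D * D * (n ∸ 1)) ⟩
    suc j * (D * D * (n ∸ 1))                ∎
    where open ≤-Reasoning

  a≤D*j*[n-1] : ∀ j → a j ≤ D * (j * (n ∸ 1))
  a≤D*j*[n-1] j = *-self-cancel-≤ (begin
    a j * a j                               ≤⟨ ⌊√⌋²≤ (h j) ⟩
    h j                                     ≤⟨ h≤j*h₁ j ⟩
    j * (D * D * (n ∸ 1))                   ≡⟨ regroup D j (n ∸ 1) ⟩
    D * D * (j * (n ∸ 1))                   ≤⟨ *-monoʳ-≤ (D * D) (m≤m*m (j * (n ∸ 1))) ⟩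
    D * D * (j * (n ∸ 1) * (j * (n ∸ 1)))   ≡⟨ regroup′ D (j * (n ∸ 1)) ⟩
    D * (j * (n ∸ 1)) * (D * (j * (n ∸ 1))) ∎)
    where
    open ≤-Reasoning
    regroup : ∀ D j m → j * (D * D * m) ≡ D * D * (j * m)
    regroup = solve-∀
    regroup′ : ∀ D m → D * D * (m * m) ≡ D * m * (D * m)
    regroup′ = solve-∀
    m≤m*m : ∀ m → m ≤ m * m
    m≤m*m zero    = z≤n
    m≤m*m (suc m) = m≤m*n (suc m) (suc m)

record Rooting {n} (G : Graph n) : Set where
  field
    root        : Fin n
    parent      : Fin n → Fin n
    rank        : Fin n → ℕ
    parent-root : parent root ≡ root
    parent-adj  : ∀ x → x ≢ root → Adj G x (parent x)
    rank-parent : ∀ x → x ≢ root → rank (parent x) < rank x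

module Rooted {n} {G : Graph n} (R : Rooting G) where
  open Rooting R

  parent-ind : (P : Fin n → Set) → (∀ x → (x ≢ root → P (parent x)) → P x) → ∀ x → P x
  parent-ind P step = WF.All.wfRec (On.wellFounded rank <-wellFounded) _ P λ x rec →
    step x λ x≢root → rec (rank-parent x x≢root)

  rank-parent-< : ∀ {x k} → x ≢ root → rank x ≤ k → rank (parent x) < k
  rank-parent-< {x} x≢root rx≤k = ≤-trans (rank-parent x x≢root) rx≤k

  -- x ≼ z: x lies on the path from z up to the root.  The fuel rank z suffices
  -- because ranks strictly decrease along parents.
  ancestor? : ℕ → Fin n → Fin n → Bool
  ancestor? zero    x z = does (x ≟ᶠ z)
  ancestor? (suc k) x z = does (x ≟ᶠ z) ∨ ancestor? k x (parent z)

  infix 7 _≼_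
  _≼_ : Fin n → Fin n → Bool
  x ≼ z = ancestor? (rank z) x z

  ancestor?-root : ∀ k x → ancestor? k x root ≡ does (x ≟ᶠ root)
  ancestor?-root zero    x = refl
  ancestor?-root (suc k) x rewrite parent-root | ancestor?-root k x = ∨-idem _

  ancestor?-stable : ∀ x z {k l} → rank z ≤ k → rank z ≤ l → ancestor? k x z ≡ ancestor? l x z
  ancestor?-stable x = parent-ind _ step
    where
    step : ∀ z → (z ≢ root → ∀ {k l} → rank (parent z) ≤ k → rank (parent z) ≤ l →
                  ancestor? k x (parent z) ≡ ancestor? l x (parent z)) →
           ∀ {k l} → rank z ≤ k → rank z ≤ l → ancestor? k x z ≡ ancestor? l x z
    step z ih {k} {l} _ _ with z ≟ᶠ root
    ... | yes refl = trans (ancestor?-root k x) (sym (ancestor?-root l x))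
    step z ih {zero}  {l}     rz≤k _ | no z≢root = ⊥-elim (n≮0 (rank-parent-< z≢root rz≤k))
    step z ih {suc k} {zero}  _ rz≤l | no z≢root = ⊥-elim (n≮0 (rank-parent-< z≢root rz≤l))
    step z ih {suc k} {suc l} rz≤k rz≤l | no z≢root =
      cong (does (x ≟ᶠ z) ∨_) (ih z≢root (≤-pred (rank-parent-< z≢root rz≤k)) (≤-pred (rank-parent-< z≢root rz≤l)))

  ≼-root : ∀ x → x ≼ root ≡ does (x ≟ᶠ root)
  ≼-root = ancestor?-root (rank root)

  ≼-unfold : ∀ x {z} → z ≢ root → x ≼ z ≡ (does (x ≟ᶠ z) ∨ x ≼ parent z)
  ≼-unfold x {z} z≢root with rank z | rank-parent z z≢root
  ... | suc k | s≤s rpz≤k = cong (does (x ≟ᶠ z) ∨_) (ancestor?-stable x (parent z) rpz≤k ≤-refl)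

  ≼-unfold-≢ : ∀ {x z} → z ≢ root → x ≢ z → x ≼ z ≡ x ≼ parent z
  ≼-unfold-≢ {x} {z} z≢root x≢z = trans (≼-unfold x z≢root) (cong (_∨ x ≼ parent z) (dec-false (x ≟ᶠ z) x≢z))

  ≼-inv : ∀ {x z} → x ≼ z ≡ true → x ≡ z ⊎ (z ≢ root × x ≼ parent z ≡ true)
  ≼-inv {x} {z} x≼z with z ≟ᶠ root
  ... | yes refl = inj₁ (≟-true (trans (sym (≼-root x)) x≼z))
  ... | no z≢root with x ≟ᶠ z | ≼-unfold x z≢root
  ...   | yes x≡z | _      = inj₁ x≡z
  ...   | no _    | unfold = inj₂ (z≢root , trans (sym unfold) x≼z)

  ≼-step : ∀ {x z} → z ≢ root → x ≼ parent z ≡ true → x ≼ z ≡ true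
  ≼-step {x} z≢root x≼pz = trans (≼-unfold x z≢root) (trans (cong (_ ∨_) x≼pz) (∨-zeroʳ _))

  ≼-refl : ∀ x → x ≼ x ≡ true
  ≼-refl x with x ≟ᶠ root
  ... | yes refl  = trans (≼-root root) (dec-true (root ≟ᶠ root) refl)
  ... | no x≢root = trans (≼-unfold x x≢root) (cong (_∨ x ≼ parent x) (dec-true (x ≟ᶠ x) refl))

  root-≼ : ∀ z → root ≼ z ≡ true
  root-≼ = parent-ind (λ z → root ≼ z ≡ true) λ z ih → case z ≟ᶠ root of λ where
    (yes refl)  → ≼-refl root
    (no z≢root) → ≼-step z≢root (ih z≢root)

  ≼-rank : ∀ {x z} → x ≼ z ≡ true → x ≡ z ⊎ rank x < rank z
  ≼-rank {x} {z} = parent-ind (λ z → x ≼ z ≡ true → x ≡ z ⊎ rank x < rank z) step z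
    where
    step : ∀ z → (z ≢ root → x ≼ parent z ≡ true → x ≡ parent z ⊎ rank x < rank (parent z)) →
           x ≼ z ≡ true → x ≡ z ⊎ rank x < rank z
    step z ih x≼z with ≼-inv x≼z
    ... | inj₁ x≡z = inj₁ x≡z
    ... | inj₂ (z≢root , x≼pz) with ih z≢root x≼pz
    ...   | inj₁ refl = inj₂ (rank-parent z z≢root)
    ...   | inj₂ lt   = inj₂ (<-trans lt (rank-parent z z≢root))

  ≼-rank-≤ : ∀ {x z} → x ≼ z ≡ true → rank x ≤ rank z
  ≼-rank-≤ x≼z with ≼-rank x≼z
  ... | inj₁ refl = ≤-refl
  ... | inj₂ lt   = <⇒≤ lt

  ≼-trans : ∀ {x y z} → x ≼ y ≡ true → y ≼ z ≡ true → x ≼ z ≡ true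
  ≼-trans {x} {y} {z} x≼y = parent-ind (λ z → y ≼ z ≡ true → x ≼ z ≡ true) step z
    where
    step : ∀ z → (z ≢ root → y ≼ parent z ≡ true → x ≼ parent z ≡ true) → y ≼ z ≡ true → x ≼ z ≡ true
    step z ih y≼z with ≼-inv y≼z
    ... | inj₁ refl            = x≼y
    ... | inj₂ (z≢root , y≼pz) = ≼-step z≢root (ih z≢root y≼pz)

  ≼-total : ∀ {x y v} → x ≼ v ≡ true → y ≼ v ≡ true → x ≼ y ≡ true ⊎ y ≼ x ≡ true
  ≼-total {x} {y} {v} = parent-ind (λ v → x ≼ v ≡ true → y ≼ v ≡ true → x ≼ y ≡ true ⊎ y ≼ x ≡ true) step v
    where
    step : ∀ v → (v ≢ root → x ≼ parent v ≡ true → y ≼ parent v ≡ true → x ≼ y ≡ true ⊎ y ≼ x ≡ true) →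
           x ≼ v ≡ true → y ≼ v ≡ true → x ≼ y ≡ true ⊎ y ≼ x ≡ true
    step v ih x≼v y≼v with ≼-inv x≼v | ≼-inv y≼v
    ... | inj₁ refl | _         = inj₂ y≼v
    ... | _         | inj₁ refl = inj₁ x≼v
    ... | inj₂ (v≢root , x≼pv) | inj₂ (_ , y≼pv) = ih v≢root x≼pv y≼pv

  ≼-antisym : ∀ {x z} → x ≢ z → x ≼ z ≡ true → z ≼ x ≡ false
  ≼-antisym {x} {z} x≢z x≼z with z ≼ x in z≼x
  ... | false = refl
  ... | true with ≼-rank x≼z | ≼-rank z≼x
  ...   | inj₁ x≡z | _        = ⊥-elim (x≢z x≡z)
  ...   | _        | inj₁ z≡x = ⊥-elim (x≢z (sym z≡x))
  ...   | inj₂ lt  | inj₂ gt  = ⊥-elim (<-asym lt gt)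

  parent-≼ : ∀ z → parent z ≼ z ≡ true
  parent-≼ z with z ≟ᶠ root
  ... | yes refl  = subst (λ p → p ≼ root ≡ true) (sym parent-root) (≼-refl root)
  ... | no z≢root = ≼-step z≢root (≼-refl (parent z))

  ≼-parent : ∀ {z} → z ≢ root → z ≼ parent z ≡ false
  ≼-parent {z} z≢root = ≼-antisym pz≢z (parent-≼ z)
    where
    pz≢z : parent z ≢ z
    pz≢z pz≡z = <-irrefl (cong rank pz≡z) (rank-parent z z≢root)

  ⋠⇒≢root : ∀ {x z} → x ≼ z ≡ false → x ≢ root
  ⋠⇒≢root {z = z} x⋠z refl with () ← trans (sym (root-≼ z)) x⋠z

  sum-≼-parent : ∀ {y} → y ≢ root → (φ : Fin n → Bool → ℕ) →
                 ∑[ z < n ] φ z (z ≼ y) + φ y false ≡ ∑[ z < n ] φ z (z ≼ parent y) + φ y true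
  sum-≼-parent {y} y≢root φ
    with sum-except y (λ z → φ z (z ≼ y)) (λ z → φ z (z ≼ parent y)) (λ z z≢y → cong (φ z) (≼-unfold-≢ y≢root z≢y))
  ... | eq rewrite ≼-parent y≢root | ≼-refl y = eq

  -- the number of vertices that are ancestors of exactly one of u and w, i.e. the
  -- length of the path from u to w in the tree of parent edges
  treeDist : Fin n → Fin n → ℕ
  treeDist u w = ∑[ z < n ] ⟦ z ≼ u xor z ≼ w ⟧

  treeDist-sym : ∀ u w → treeDist u w ≡ treeDist w u
  treeDist-sym u w = sum-cong-≗ λ z → cong ⟦_⟧ (xor-comm (z ≼ u) (z ≼ w))

  treeDist-self : ∀ u → treeDist u u ≡ 0
  treeDist-self u = trans (sum-cong-≗ λ z → cong ⟦_⟧ (xor-same (z ≼ u))) (sum-zero n)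

  treeDist-parent : ∀ {y x} → y ≼ x ≡ false → treeDist y x ≡ suc (treeDist (parent y) x)
  treeDist-parent {y} {x} y⋠x with sum-≼-parent (⋠⇒≢root y⋠x) (λ z b → ⟦ b xor z ≼ x ⟧)
  ... | eq rewrite y⋠x = trans (sym (+-identityʳ _)) (trans eq (+-comm _ 1))

  treeDist-parent-≤ : ∀ {y} x → y ≢ root → treeDist y x ≤ suc (treeDist (parent y) x)
  treeDist-parent-≤ {y} x y≢root = begin
    treeDist y x                                ≤⟨ m≤m+n _ _ ⟩
    treeDist y x + ⟦ false xor y ≼ x ⟧          ≡⟨ sum-≼-parent y≢root (λ z b → ⟦ b xor z ≼ x ⟧) ⟩
    treeDist (parent y) x + ⟦ true xor y ≼ x ⟧  ≤⟨ +-monoʳ-≤ _ (⟦⟧≤1 _) ⟩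
    treeDist (parent y) x + 1                   ≡⟨ +-comm _ 1 ⟩
    suc (treeDist (parent y) x)                 ∎
    where open ≤-Reasoning

  parent-treeDist-≤ : ∀ {y} x → y ≢ root → treeDist (parent y) x ≤ suc (treeDist y x)
  parent-treeDist-≤ {y} x y≢root = begin
    treeDist (parent y) x                       ≤⟨ m≤m+n _ _ ⟩
    treeDist (parent y) x + ⟦ true xor y ≼ x ⟧  ≡⟨ sum-≼-parent y≢root (λ z b → ⟦ b xor z ≼ x ⟧) ⟨
    treeDist y x + ⟦ false xor y ≼ x ⟧          ≤⟨ +-monoʳ-≤ _ (⟦⟧≤1 _) ⟩
    treeDist y x + 1                            ≡⟨ +-comm _ 1 ⟩
    suc (treeDist y x)                          ∎
    where open ≤-Reasoning

  treeDist-through : ∀ {x c v} → c ≼ v ≡ true → c ≼ x ≡ false →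
                     treeDist x v ≡ treeDist x c + treeDist c v
  treeDist-through {x} {c} {v} c≼v c⋠x =
    trans (sum-cong-≗ split) (∑-distrib-+ (λ z → ⟦ z ≼ x xor z ≼ c ⟧) (λ z → ⟦ z ≼ c xor z ≼ v ⟧))
    where
    split : ∀ z → ⟦ z ≼ x xor z ≼ v ⟧ ≡ ⟦ z ≼ x xor z ≼ c ⟧ + ⟦ z ≼ c xor z ≼ v ⟧
    split z with z ≼ c in z≼c
    ... | true rewrite ≼-trans z≼c c≼v = sym (+-identityʳ _)
    ... | false with z ≼ v in z≼v
    ...   | false = sym (+-identityʳ _)
    ...   | true with z ≼ x in z≼x | ≼-total z≼v c≼v
    ...     | false | _         = refl
    ...     | true  | inj₁ z≼c′ with () ← trans (sym z≼c) z≼c′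
    ...     | true  | inj₂ c≼z  with () ← trans (sym c⋠x) (≼-trans c≼z z≼x)

  ParentEdges : Set
  ParentEdges = ∀ {x y} → Adj G x y → (x ≢ root × y ≡ parent x) ⊎ (y ≢ root × x ≡ parent y)

  treeDist≤walk : ParentEdges → ∀ {x y k} → Walk G x y k → treeDist x y ≤ k
  treeDist≤walk edges {x} nil = ≤-reflexive (treeDist-self x)
  treeDist≤walk edges {y = y} (cons a w) with edges a
  ... | inj₁ (x≢root , refl)  = ≤-trans (treeDist-parent-≤ y x≢root) (s≤s (treeDist≤walk edges w))
  ... | inj₂ (x′≢root , refl) = ≤-trans (parent-treeDist-≤ y x′≢root) (s≤s (treeDist≤walk edges w))

module Distances {n} (G : Graph n) (dist : Fin n → Fin n → ℕ)
                 (isDist : ∀ u v → IsDistance G u v (dist u v)) where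

  Adj-sym : ∀ {u v} → Adj G u v → Adj G v u
  Adj-sym {u} {v} = subst T (Graph.adj-sym G u v)

  Adj-irrefl : ∀ {u v} → Adj G u v → u ≢ v
  Adj-irrefl {u} a refl = Graph.adj-irr G u a

  geodesic : ∀ u v → Walk G u v (dist u v)
  geodesic u v = proj₁ (isDist u v)

  dist-minimal : ∀ {u v k} → Walk G u v k → dist u v ≤ k
  dist-minimal {u} {v} {k} = proj₂ (isDist u v) k

  walk-snoc : ∀ {u v w k} → Walk G u v k → Adj G v w → Walk G u w (suc k)
  walk-snoc nil        a = cons a nil
  walk-snoc (cons b w) a = cons b (walk-snoc w a)

  walk-reverse : ∀ {u v k} → Walk G u v k → Walk G v u k
  walk-reverse nil        = nil
  walk-reverse (cons a w) = walk-snoc (walk-reverse w) (Adj-sym a)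

  dist-refl : ∀ u → dist u u ≡ 0
  dist-refl u = n≤0⇒n≡0 (dist-minimal nil)

  dist-sym : ∀ u v → dist u v ≡ dist v u
  dist-sym u v = ≤-antisym (dist-minimal (walk-reverse (geodesic v u))) (dist-minimal (walk-reverse (geodesic u v)))

  dist≡0⇒≡ : ∀ {u v} → dist u v ≡ 0 → u ≡ v
  dist≡0⇒≡ {u} {v} d≡0 with subst (Walk G u v) d≡0 (geodesic u v)
  ... | nil = refl

  dist-stepˡ : ∀ {u w} v → Adj G u w → dist u v ≤ suc (dist w v)
  dist-stepˡ v a = dist-minimal (cons a (geodesic _ v))

  dist-stepʳ : ∀ u {v w} → Adj G v w → dist u w ≤ suc (dist u v)
  dist-stepʳ u a = dist-minimal (walk-snoc (geodesic u _) a)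

  dist≤treeDist : (R : Rooting G) → ∀ u w → dist u w ≤ Rooted.treeDist R u w
  dist≤treeDist R u w = parent-ind (λ w → ∀ u → dist u w ≤ treeDist u w) outer w u
    where
    open Rooting R
    open Rooted R
    outer : ∀ w → (w ≢ root → ∀ u → dist u (parent w) ≤ treeDist u (parent w)) →
            ∀ u → dist u w ≤ treeDist u w
    outer w ihw = parent-ind (λ u → dist u w ≤ treeDist u w) inner
      where
      inner : ∀ u → (u ≢ root → dist (parent u) w ≤ treeDist (parent u) w) → dist u w ≤ treeDist u w
      inner u ihu with u ≼ w in u≼w
      ... | false = begin
        dist u w                    ≤⟨ dist-stepˡ w (parent-adj u (⋠⇒≢root u≼w)) ⟩
        suc (dist (parent u) w)     ≤⟨ s≤s (ihu (⋠⇒≢root u≼w)) ⟩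
        suc (treeDist (parent u) w) ≡⟨ treeDist-parent u≼w ⟨
        treeDist u w                ∎
        where open ≤-Reasoning
      ... | true with u ≟ᶠ w
      ...   | yes refl = subst (_≤ treeDist u u) (sym (dist-refl u)) z≤n
      ...   | no u≢w = begin
        dist u w                    ≤⟨ dist-stepʳ u (Adj-sym (parent-adj w w≢root)) ⟩
        suc (dist u (parent w))     ≤⟨ s≤s (ihw w≢root u) ⟩
        suc (treeDist u (parent w)) ≡⟨ cong suc (treeDist-sym u (parent w)) ⟩
        suc (treeDist (parent w) u) ≡⟨ treeDist-parent w⋠u ⟨
        treeDist w u                ≡⟨ treeDist-sym w u ⟩
        treeDist u w                ∎
        where
        open ≤-Reasoning
        w⋠u : w ≼ u ≡ false
        w⋠u = ≼-antisym u≢w u≼w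
        w≢root : w ≢ root
        w≢root = ⋠⇒≢root w⋠u

  module BFS (c : Fin n) where

    descend : ∀ x → x ≢ c → ∃ λ y → Adj G x y × suc (dist y c) ≡ dist x c
    descend x x≢c with dist x c in eq
    ... | zero  = ⊥-elim (x≢c (dist≡0⇒≡ eq))
    ... | suc k with subst (Walk G x c) eq (geodesic x c)
    ...   | cons {w = y} a w = y , a , ≤-antisym (s≤s (dist-minimal w)) (subst (_≤ suc (dist y c)) eq (dist-stepˡ c a))

    parentOf : ∀ x → Dec (x ≡ c) → Fin n
    parentOf x (yes _)  = c
    parentOf x (no x≢c) = proj₁ (descend x x≢c)

    bfsParent : Fin n → Fin n
    bfsParent x = parentOf x (x ≟ᶠ c)

    bfsParent-descends : ∀ {x} → x ≢ c → Adj G x (bfsParent x) × suc (dist (bfsParent x) c) ≡ dist x c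
    bfsParent-descends {x} x≢c with x ≟ᶠ c
    ... | yes x≡c  = ⊥-elim (x≢c x≡c)
    ... | no x≢c′ = proj₂ (descend x x≢c′)

    bfsParent-c : bfsParent c ≡ c
    bfsParent-c with c ≟ᶠ c
    ... | yes _  = refl
    ... | no c≢c = ⊥-elim (c≢c refl)

    rooting : Rooting G
    rooting = record
      { root        = c
      ; parent      = bfsParent
      ; rank        = λ x → dist x c
      ; parent-root = bfsParent-c
      ; parent-adj  = λ x x≢c → proj₁ (bfsParent-descends x≢c)
      ; rank-parent = λ x x≢c → ≤-reflexive (proj₂ (bfsParent-descends x≢c))
      }

    open Rooted rooting public

    dist-bfsParent : ∀ {x} → x ≢ c → suc (dist (bfsParent x) c) ≡ dist x c
    dist-bfsParent x≢c = proj₂ (bfsParent-descends x≢c)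

    dist-pred : ∀ x → pred (dist x c) ≡ dist (bfsParent x) c
    dist-pred x = by-cases (x ≟ᶠ c)
      where
      at-c : pred (dist c c) ≡ dist (bfsParent c) c
      at-c = trans (cong pred (dist-refl c)) (sym (trans (cong (λ y → dist y c) bfsParent-c) (dist-refl c)))
      by-cases : Dec (x ≡ c) → pred (dist x c) ≡ dist (bfsParent x) c
      by-cases (yes x≡c) = subst (λ y → pred (dist y c) ≡ dist (bfsParent y) c) (sym x≡c) at-c
      by-cases (no x≢c)  = sym (cong pred (dist-bfsParent x≢c))

    dist≡suc⇒≢c : ∀ {x k} → dist x c ≡ suc k → x ≢ c
    dist≡suc⇒≢c {x} rx refl with () ← trans (sym rx) (dist-refl x)

    level-below : ∀ {x k} → dist x c ≡ suc k → Adj G x (bfsParent x) × dist (bfsParent x) c ≡ k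
    level-below rx with bfsParent-descends (dist≡suc⇒≢c rx)
    ... | a , e = a , suc-injective (trans e rx)

    closer-∉ : ∀ {x k L} → dist x c ≡ k → All (λ z → k < dist z c) L → All (x ≢_) L
    closer-∉ {x} rx = All.map λ {z} k<rz x≡z → <-irrefl (trans (sym rx) (cong (λ v → dist v c) x≡z)) k<rz

    treeDist-ancestor : ∀ {w v} → w ≼ v ≡ true → treeDist w v ≡ dist v c ∸ dist w c
    treeDist-ancestor {w} {v} = parent-ind (λ v → w ≼ v ≡ true → treeDist w v ≡ dist v c ∸ dist w c) step v
      where
      step : ∀ v → (v ≢ c → w ≼ bfsParent v ≡ true → treeDist w (bfsParent v) ≡ dist (bfsParent v) c ∸ dist w c) →
             w ≼ v ≡ true → treeDist w v ≡ dist v c ∸ dist w c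
      step v ih w≼v with ≼-inv w≼v
      ... | inj₁ refl = trans (treeDist-self w) (sym (n∸n≡0 (dist w c)))
      ... | inj₂ (v≢c , w≼pv) = begin
        treeDist w v                           ≡⟨ treeDist-sym w v ⟩
        treeDist v w                           ≡⟨ treeDist-parent v⋠w ⟩
        suc (treeDist (bfsParent v) w)         ≡⟨ cong suc (trans (treeDist-sym _ w) (ih v≢c w≼pv)) ⟩
        suc (dist (bfsParent v) c ∸ dist w c)  ≡⟨ +-∸-assoc 1 (≼-rank-≤ w≼pv) ⟨
        suc (dist (bfsParent v) c) ∸ dist w c  ≡⟨ cong (_∸ dist w c) (dist-bfsParent v≢c) ⟩
        dist v c ∸ dist w c                    ∎
        where
        open ≡-Reasoning
        v⋠w : v ≼ w ≡ false
        v⋠w with v ≼ w in v≼w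
        ... | false = refl
        ... | true with () ← trans (sym (≼-parent v≢c)) (≼-trans v≼w w≼pv)

    ancestor-at : ∀ {k} x → k ≤ dist x c → ∃ λ a → a ≼ x ≡ true × dist a c ≡ k
    ancestor-at {k} = parent-ind (λ x → k ≤ dist x c → ∃ λ a → a ≼ x ≡ true × dist a c ≡ k) step
      where
      step : ∀ x → (x ≢ c → k ≤ dist (bfsParent x) c → ∃ λ a → a ≼ bfsParent x ≡ true × dist a c ≡ k) →
             k ≤ dist x c → ∃ λ a → a ≼ x ≡ true × dist a c ≡ k
      step x ih k≤rx with m≤n⇒m<n∨m≡n k≤rx
      ... | inj₂ k≡rx = x , ≼-refl x , sym k≡rx
      ... | inj₁ k<rx =
        let a , a≼px , ra = ih x≢c (≤-pred (subst (k <_) (sym (dist-bfsParent x≢c)) k<rx)) in a , ≼-step x≢c a≼px , ra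
        where
        x≢c : x ≢ c
        x≢c refl = n≮0 (subst (k <_) (dist-refl c) k<rx)

    module _ (acyclic : ¬ HasCycle G) where

      -- Climbing from a and b towards c in lockstep closes the path into a cycle.
      no-level-path : ∀ k {a b} M → dist a c ≡ k → dist b c ≡ k → a ≢ b →
                      All (λ z → k < dist z c) M → Unique M → Linked (Adj G) (a ∷ M ∷ʳ b) → ⊥
      no-level-path zero    M ra rb a≢b _ _ _ = a≢b (trans (dist≡0⇒≡ ra) (sym (dist≡0⇒≡ rb)))
      no-level-path (suc k) {a} {b} M ra rb a≢b deep uniq path = climb (bfsParent a ≟ᶠ bfsParent b)
        where
        path-unique : Unique (a ∷ M ∷ʳ b)
        path-unique = ∷ʳ⁺ (closer-∉ ra deep) a≢b ∷ unique-∷ʳ uniq (All.map (λ b≢z z≡b → b≢z (sym z≡b)) (closer-∉ rb deep))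
        path-deep : All (λ z → k < dist z c) (a ∷ M ∷ʳ b)
        path-deep = ≤-reflexive (sym ra) ∷ ∷ʳ⁺ (All.map (<-trans (n<1+n k)) deep) (≤-reflexive (sym rb))
        climb : Dec (bfsParent a ≡ bfsParent b) → ⊥
        climb (yes pa≡pb) = acyclic (bfsParent a , a ∷ M ∷ʳ b , s≤s (1≤length-∷ʳ M) ,
          closer-∉ (proj₂ (level-below ra)) path-deep ∷ path-unique ,
          Adj-sym (proj₁ (level-below ra)) ∷ linked-∷ʳ M path (subst (Adj G b) (sym pa≡pb) (proj₁ (level-below rb))))
        climb (no pa≢pb) = no-level-path k (a ∷ M ∷ʳ b) (proj₂ (level-below ra)) (proj₂ (level-below rb)) pa≢pb
          path-deep path-unique (Adj-sym (proj₁ (level-below ra)) ∷ linked-∷ʳ M path (proj₁ (level-below rb)))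

      deeper-neighbour : ∀ {x y} → Adj G x y → dist x c < dist y c → y ≢ c × x ≡ bfsParent y
      deeper-neighbour {x} {y} a rx<ry = case x ≟ᶠ bfsParent y of λ where
          (yes x≡py) → dist≡suc⇒≢c ry , x≡py
          (no x≢py)  → ⊥-elim (no-level-path _ (y ∷ []) refl (proj₂ (level-below ry)) x≢py (rx<ry ∷ []) ([] ∷ [])
                                              (a ∷ proj₁ (level-below ry) ∷ [-]))
        where
        ry : dist y c ≡ suc (dist x c)
        ry = ≤-antisym (dist-stepˡ c (Adj-sym a)) rx<ry

      parent-edges : ParentEdges
      parent-edges {x} {y} a with <-cmp (dist x c) (dist y c)
      ... | tri≈ _ rx≡ry _ = ⊥-elim (no-level-path _ [] refl (sym rx≡ry) (Adj-irrefl a) [] [] (a ∷ [-]))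
      ... | tri< rx<ry _ _ = inj₂ (deeper-neighbour a rx<ry)
      ... | tri> _ _ ry<rx = inj₁ (deeper-neighbour (Adj-sym a) ry<rx)

      dist≡treeDist : ∀ u w → dist u w ≡ treeDist u w
      dist≡treeDist u w = ≤-antisym (dist≤treeDist rooting u w) (treeDist≤walk parent-edges (geodesic u w))

      -- For a diameter from c to v: unless x lies below m, the path from x to v runs through m.
      split-at : ∀ {a b m v} → m ≼ v ≡ true → dist m c ≡ a → dist v c ≡ a + b →
                 (∀ x y → dist x y ≤ a + b) →
                 ∀ x → (m ≼ x ≡ true × dist x m ≤ b) ⊎ (m ≼ x ≡ false × dist x m ≤ a)
      split-at {a} {b} {m} {v} m≼v rm rv diam x with m ≼ x in m≼x
      ... | true = inj₁ (refl , (begin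
        dist x m             ≡⟨ trans (dist≡treeDist x m) (treeDist-sym x m) ⟩
        treeDist m x         ≡⟨ treeDist-ancestor m≼x ⟩
        dist x c ∸ dist m c  ≤⟨ ∸-monoˡ-≤ (dist m c) (diam x c) ⟩
        a + b ∸ dist m c     ≡⟨ cong (a + b ∸_) rm ⟩
        a + b ∸ a            ≡⟨ m+n∸m≡n a b ⟩
        b                    ∎))
        where open ≤-Reasoning
      ... | false = inj₂ (refl , +-cancelʳ-≤ b _ _ (begin
        dist x m + b                 ≡⟨ cong₂ _+_ (sym (dist≡treeDist x m)) mv≡b ⟨
        treeDist x m + treeDist m v  ≡⟨ treeDist-through m≼v m≼x ⟨
        treeDist x v                 ≡⟨ dist≡treeDist x v ⟨
        dist x v                     ≤⟨ diam x v ⟩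
        a + b                        ∎))
        where
        open ≤-Reasoning
        mv≡b : treeDist m v ≡ b
        mv≡b = trans (treeDist-ancestor m≼v) (trans (cong₂ _∸_ rv rm) (m+n∸m≡n a b))

  center-even : ¬ HasCycle G → ∀ ℓ → IsDiameter dist (2 * ℓ) → ∃ λ c → ∀ x → dist x c ≤ ℓ
  center-even acyclic ℓ ((u , v , uv≡2ℓ) , diam) = m , λ x → case split-at acyclic m≼v rm vu≡ diam′ x of λ where
      (inj₁ (_ , xm≤ℓ)) → xm≤ℓ
      (inj₂ (_ , xm≤ℓ)) → xm≤ℓ
    where
    open BFS u
    vu≡ : dist v u ≡ ℓ + ℓ
    vu≡ = trans (dist-sym v u) (trans uv≡2ℓ (2*ℓ≡ℓ+ℓ ℓ))
    diam′ : ∀ x y → dist x y ≤ ℓ + ℓ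
    diam′ x y = subst (dist x y ≤_) (2*ℓ≡ℓ+ℓ ℓ) (diam x y)
    middle : ∃ λ m → m ≼ v ≡ true × dist m u ≡ ℓ
    middle = ancestor-at v (subst (ℓ ≤_) (sym vu≡) (m≤m+n ℓ ℓ))
    m : Fin n
    m = proj₁ middle
    m≼v : m ≼ v ≡ true
    m≼v = proj₁ (proj₂ middle)
    rm : dist m u ≡ ℓ
    rm = proj₂ (proj₂ middle)

  center-odd : ¬ HasCycle G → ∀ ℓ → IsDiameter dist (2 * ℓ + 1) →
               ∃ λ c₁ → ∃ λ c₂ → Adj G c₂ c₁ × (∀ x → dist x c₁ ≤ ℓ ⊎ dist x c₂ ≤ ℓ)
  center-odd acyclic ℓ ((u , v , uv≡2ℓ+1) , diam) = bfsParent m , m , proj₁ (level-below rm) , bound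
    where
    open BFS u
    vu≡ : dist v u ≡ suc ℓ + ℓ
    vu≡ = trans (dist-sym v u) (trans uv≡2ℓ+1 (2*ℓ+1≡1+ℓ+ℓ ℓ))
    diam′ : ∀ x y → dist x y ≤ suc ℓ + ℓ
    diam′ x y = subst (dist x y ≤_) (2*ℓ+1≡1+ℓ+ℓ ℓ) (diam x y)
    middle : ∃ λ m → m ≼ v ≡ true × dist m u ≡ suc ℓ
    middle = ancestor-at v (subst (suc ℓ ≤_) (sym vu≡) (m≤m+n (suc ℓ) ℓ))
    m : Fin n
    m = proj₁ middle
    m≼v : m ≼ v ≡ true
    m≼v = proj₁ (proj₂ middle)
    rm : dist m u ≡ suc ℓ
    rm = proj₂ (proj₂ middle)
    bound : ∀ x → dist x (bfsParent m) ≤ ℓ ⊎ dist x m ≤ ℓ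
    bound x with split-at acyclic m≼v rm vu≡ diam′ x
    ... | inj₁ (_ , xm≤ℓ)     = inj₂ xm≤ℓ
    ... | inj₂ (m⋠x , xm≤1+ℓ) = inj₁ (≤-pred (begin
      suc (dist x (bfsParent m))      ≡⟨ cong suc (trans (dist-sym x _) (dist≡treeDist acyclic _ x)) ⟩
      suc (treeDist (bfsParent m) x)  ≡⟨ treeDist-parent m⋠x ⟨
      treeDist m x                    ≡⟨ trans (treeDist-sym m x) (sym (dist≡treeDist acyclic x m)) ⟩
      dist x m                        ≤⟨ xm≤1+ℓ ⟩
      suc ℓ                           ∎))
      where open ≤-Reasoning

levelSum : (ℕ → ℕ) → ℕ → ℕ
levelSum F zero    = 0
levelSum F (suc L) = levelSum F L + F (suc L)

levelSum-telescope : ∀ F L → levelSum F (suc L) + F (suc (suc L)) ≡ levelSum (F ∘ suc) (suc L) + F 1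
levelSum-telescope F zero    = +-comm (F 1) (F 2)
levelSum-telescope F (suc L) = begin
  levelSum F (suc L) + F (2 + L) + F (3 + L)      ≡⟨ cong (_+ F (3 + L)) (levelSum-telescope F L) ⟩
  levelSum (F ∘ suc) (suc L) + F 1 + F (3 + L)    ≡⟨ swap (levelSum (F ∘ suc) (suc L)) (F 1) (F (3 + L)) ⟩
  levelSum (F ∘ suc) (suc L) + F (3 + L) + F 1    ∎
  where
  open ≡-Reasoning
  swap : ∀ a b c → a + b + c ≡ a + c + b
  swap = solve-∀

module Subtrees {n} {G : Graph n} (R : Rooting G) where
  open Rooting R
  open Rooted R

  size outside : Fin n → ℕ
  size    z = count (z ≼_)
  outside z = count (not ∘ (z ≼_))

  outside-root : outside root ≡ 0
  outside-root = trans (sum-cong-≗ {n} λ w → cong (⟦_⟧ ∘ not) (root-≼ w)) (sum-zero n)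

  wiener≤∑size*outside : (dist : Fin n → Fin n → ℕ) → (∀ u v → IsDistance G u v (dist u v)) →
                         wiener dist ≤ ∑[ z < n ] (size z * outside z)
  wiener≤∑size*outside dist isDist = begin
    wiener dist                                       ≡⟨ wiener≡pairSum dist ⟩
    pairSum dist                                      ≤⟨ pairSum-mono-≤ (Distances.dist≤treeDist G dist isDist R) ⟩
    pairSum treeDist                                  ≡⟨ pairSum-∑ (λ z u w → ⟦ z ≼ u xor z ≼ w ⟧) ⟩
    ∑[ z < n ] pairSum (λ u w → ⟦ z ≼ u xor z ≼ w ⟧)  ≡⟨ sum-cong-≗ {n} (λ z → pairSum-xor (z ≼_)) ⟩
    ∑[ z < n ] (size z * outside z)                   ∎
    where open ≤-Reasoning

  size-* : ∀ x v → size x * v ≡ ∑[ z < n ] (if x ≼ z then v else 0)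
  size-* x v = trans (*-distribʳ-sum v (λ z → ⟦ x ≼ z ⟧)) (sum-cong-≗ {n} λ z → ⟦⟧-* (x ≼ z))
    where
    ⟦⟧-* : ∀ b → ⟦ b ⟧ * v ≡ (if b then v else 0)
    ⟦⟧-* true  = +-identityʳ v
    ⟦⟧-* false = refl

  -- Levels drop by one along parent edges until they reach the core {x ∣ lev x ≡ 0},
  -- which contains the root.
  module Levels (lev : Fin n → ℕ) (lev-parent : ∀ x → pred (lev x) ≡ lev (parent x)) where

    offCore : Fin n → ℕ → ℕ
    offCore x v = if lev x ≡ᵇ 0 then 0 else v

    offCore-zero : ∀ {x} v → lev x ≡ 0 → offCore x v ≡ 0
    offCore-zero {x} v lx≡0 rewrite lx≡0 = refl

    offCore-pos : ∀ {x} v → lev x ≢ 0 → offCore x v ≡ v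
    offCore-pos {x} v lx≢0 with lev x
    ... | zero  = ⊥-elim (lx≢0 refl)
    ... | suc _ = refl

    offCore-≤ : ∀ x v → offCore x v ≤ v
    offCore-≤ x v with lev x
    ... | zero  = z≤n
    ... | suc _ = ≤-refl

    ∑offCore-+ : ∀ (f g : Fin n → ℕ) →
                 ∑[ x < n ] offCore x (f x + g x) ≡ ∑[ x < n ] offCore x (f x) + ∑[ x < n ] offCore x (g x)
    ∑offCore-+ f g = trans (sum-cong-≗ {n} pointwise) (∑-distrib-+ {n} _ _)
      where
      pointwise : ∀ x → offCore x (f x + g x) ≡ offCore x (f x) + offCore x (g x)
      pointwise x with lev x
      ... | zero  = refl
      ... | suc _ = refl

    ∑offCore-mono-≤ : ∀ {f g : Fin n → ℕ} → (∀ x → f x ≤ g x) →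
                      ∑[ x < n ] offCore x (f x) ≤ ∑[ x < n ] offCore x (g x)
    ∑offCore-mono-≤ {f} {g} f≤g = sum-mono-≤ pointwise
      where
      pointwise : ∀ x → offCore x (f x) ≤ offCore x (g x)
      pointwise x with lev x
      ... | zero  = z≤n
      ... | suc _ = f≤g x

    ∑offCore-* : ∀ k (f : Fin n → ℕ) → ∑[ x < n ] offCore x (k * f x) ≡ k * ∑[ x < n ] offCore x (f x)
    ∑offCore-* k f = trans (sum-cong-≗ {n} pointwise) (sym (*-distribˡ-sum {n} k _))
      where
      pointwise : ∀ x → offCore x (k * f x) ≡ k * offCore x (f x)
      pointwise x with lev x
      ... | zero  = sym (*-zeroʳ k)
      ... | suc _ = refl

    offCoreCount : ℕ
    offCoreCount = ∑[ x < n ] offCore x 1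

    ∑offCore-const : ∀ v → ∑[ x < n ] offCore x v ≡ offCoreCount * v
    ∑offCore-const v = trans (sum-cong-≗ {n} pointwise) (sym (*-distribʳ-sum {n} v _))
      where
      pointwise : ∀ x → offCore x v ≡ offCore x 1 * v
      pointwise x with lev x
      ... | zero  = refl
      ... | suc _ = sym (+-identityʳ v)

    lev-root : lev root ≡ 0
    lev-root = fixed-pred (trans (cong lev (sym parent-root)) (sym (lev-parent root)))
      where
      fixed-pred : ∀ {m} → m ≡ pred m → m ≡ 0
      fixed-pred {zero}  _  = refl
      fixed-pred {suc m} eq = ⊥-elim (1+n≢n eq)

    lev-≼ : ∀ {x z} → x ≼ z ≡ true → lev x ≤ lev z
    lev-≼ {x} {z} = parent-ind (λ z → x ≼ z ≡ true → lev x ≤ lev z) step z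
      where
      step : ∀ z → (z ≢ root → x ≼ parent z ≡ true → lev x ≤ lev (parent z)) → x ≼ z ≡ true → lev x ≤ lev z
      step z ih x≼z with ≼-inv x≼z
      ... | inj₁ refl = ≤-refl
      ... | inj₂ (z≢root , x≼pz) = ≤-trans (ih z≢root x≼pz) (≤-trans (≤-reflexive (sym (lev-parent z))) pred[n]≤n)

    -- the ancestors of z off the core have levels lev z, lev z - 1, …, 1
    path-sum : ∀ F z → ∑[ x < n ] offCore x (if x ≼ z then F (lev x) else 0) ≡ levelSum F (lev z)
    path-sum F = parent-ind (λ z → ∑[ x < n ] φ x (x ≼ z) ≡ levelSum F (lev z)) step
      where
      φ : Fin n → Bool → ℕ
      φ x b = offCore x (if b then F (lev x) else 0)
      φ-false : ∀ x → φ x false ≡ 0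
      φ-false x with lev x
      ... | zero  = refl
      ... | suc _ = refl
      step : ∀ z → (z ≢ root → ∑[ x < n ] φ x (x ≼ parent z) ≡ levelSum F (lev (parent z))) →
             ∑[ x < n ] φ x (x ≼ z) ≡ levelSum F (lev z)
      step z ih with lev z in lz
      ... | zero = trans (sum-cong-≗ {n} core) (sum-zero n)
        where
        core : ∀ x → φ x (x ≼ z) ≡ 0
        core x with x ≼ z in x≼z
        ... | false = φ-false x
        ... | true  = offCore-zero _ (n≤0⇒n≡0 (subst (lev x ≤_) lz (lev-≼ x≼z)))
      ... | suc L = begin
        ∑[ x < n ] φ x (x ≼ z)                    ≡⟨ +-identityʳ _ ⟨
        ∑[ x < n ] φ x (x ≼ z) + 0                ≡⟨ cong (∑[ x < n ] φ x (x ≼ z) +_) (φ-false z) ⟨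
        ∑[ x < n ] φ x (x ≼ z) + φ z false        ≡⟨ sum-≼-parent z≢root φ ⟩
        ∑[ x < n ] φ x (x ≼ parent z) + φ z true  ≡⟨ cong₂ _+_ (ih z≢root) (offCore-pos _ (λ lz≡0 → 0≢1+n (trans (sym lz≡0) lz))) ⟩
        levelSum F (lev (parent z)) + F (lev z)   ≡⟨ cong₂ (λ m k → levelSum F m + F k) lpz lz ⟩
        levelSum F (suc L)                        ∎
        where
        open ≡-Reasoning
        z≢root : z ≢ root
        z≢root refl with () ← trans (sym lev-root) lz
        lpz : lev (parent z) ≡ L
        lpz = trans (sym (lev-parent z)) (cong pred lz)

    ∑offCore-size : ∀ (φ : Fin n → ℕ) →
                    ∑[ x < n ] offCore x (size x * φ x) ≡ ∑[ z < n ] ∑[ x < n ] offCore x (if x ≼ z then φ x else 0)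
    ∑offCore-size φ = trans (sum-cong-≗ {n} pointwise) (∑-comm {n} {n} _)
      where
      pointwise : ∀ x → offCore x (size x * φ x) ≡ ∑[ z < n ] offCore x (if x ≼ z then φ x else 0)
      pointwise x with lev x
      ... | zero  = sym (sum-zero n)
      ... | suc _ = size-* x (φ x)

    telescope : ∀ F → ∑[ x < n ] offCore x (size x * F (lev x)) + ∑[ x < n ] offCore x (F (suc (lev x)))
                    ≡ ∑[ x < n ] offCore x (size x * F (suc (lev x))) + ∑[ x < n ] offCore x (F 1)
    telescope F = begin
      ∑[ x < n ] offCore x (size x * F (lev x)) + ∑[ x < n ] offCore x (F (suc (lev x)))
        ≡⟨ cong (_+ ∑[ x < n ] offCore x (F (suc (lev x)))) (trans (∑offCore-size (F ∘ lev)) (sum-cong-≗ {n} (path-sum F))) ⟩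
      ∑[ z < n ] levelSum F (lev z) + ∑[ z < n ] offCore z (F (suc (lev z)))
        ≡⟨ ∑-distrib-+ {n} (levelSum F ∘ lev) _ ⟨
      ∑[ z < n ] (levelSum F (lev z) + offCore z (F (suc (lev z))))
        ≡⟨ sum-cong-≗ {n} at ⟩
      ∑[ z < n ] (levelSum (F ∘ suc) (lev z) + offCore z (F 1))
        ≡⟨ ∑-distrib-+ {n} (levelSum (F ∘ suc) ∘ lev) _ ⟩
      ∑[ z < n ] levelSum (F ∘ suc) (lev z) + ∑[ z < n ] offCore z (F 1)
        ≡⟨ cong (_+ ∑[ z < n ] offCore z (F 1)) (trans (∑offCore-size (F ∘ suc ∘ lev)) (sum-cong-≗ {n} (path-sum (F ∘ suc)))) ⟨
      ∑[ x < n ] offCore x (size x * F (suc (lev x))) + ∑[ x < n ] offCore x (F 1) ∎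
      where
      open ≡-Reasoning
      at : ∀ z → levelSum F (lev z) + offCore z (F (suc (lev z))) ≡ levelSum (F ∘ suc) (lev z) + offCore z (F 1)
      at z with lev z
      ... | zero  = refl
      ... | suc L = levelSum-telescope F L

module ScaledBound {n} {G : Graph n} (R : Rooting G) (lev : Fin n → ℕ)
                   (lev-parent : ∀ x → pred (lev x) ≡ lev (Rooting.parent R x))
                   (ℓ : ℕ) (lev≤ℓ : ∀ x → lev x ≤ ℓ) (D : ℕ) where
  open Rooted R
  open Subtrees R
  open Levels lev lev-parent
  open Approximants D n

  F : ℕ → ℕ
  F i = h (suc ℓ ∸ i)

  e : ℕ
  e = 2 * (D * (ℓ * (n ∸ 1)))

  j : Fin n → ℕ
  j x = ℓ ∸ lev x

  1≤size : ∀ x → 1 ≤ size x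
  1≤size x = subst (λ b → ⟦ b ⟧ ≤ size x) (≼-refl x) (≤-sum _ x)

  step-ineq : ∀ x → D * D * (size x * outside x) + (size x ∸ 1) * (a (j x) * a (j x)) ≤ size x * F (lev x)
  step-ineq x
    rewrite +-∸-assoc 1 (lev≤ℓ x)
    with subtree-step D (a (j x)) (size x) (outside x) (1≤size x)
  ... | ineq rewrite count+count-not (x ≼_) = ineq

  rounding-ineq : ∀ x → size x * F (suc (lev x)) ≤ (size x ∸ 1) * (a (j x) * a (j x)) + (size x ∸ 1) * e + F (suc (lev x))
  rounding-ineq x with size x | 1≤size x
  ... | suc s | _ = begin
    h (j x) + s * h (j x)                      ≤⟨ +-monoʳ-≤ (h (j x)) (*-monoʳ-≤ s (≤-trans (h≤a²+2a (j x)) (+-monoʳ-≤ (a (j x) * a (j x)) 2a≤e))) ⟩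
    h (j x) + s * (a (j x) * a (j x) + e)      ≡⟨ trans (+-comm (h (j x)) _) (cong (_+ h (j x)) (*-distribˡ-+ s (a (j x) * a (j x)) e)) ⟩
    s * (a (j x) * a (j x)) + s * e + h (j x)  ∎
    where
    open ≤-Reasoning
    2a≤e : 2 * a (j x) ≤ e
    2a≤e = *-monoʳ-≤ 2 (≤-trans (a≤D*j*[n-1] (j x)) (*-monoʳ-≤ D (*-monoˡ-≤ (n ∸ 1) (m∸n≤m ℓ (lev x)))))

  scaled-bound : D * D * ∑[ x < n ] offCore x (size x * outside x) ≤ n * (n * e) + ∑[ x < n ] offCore x (h ℓ)
  scaled-bound = +-cancelʳ-≤ (Σa² + Σnext) _ _ (begin
    D * D * ∑[ x < n ] offCore x (size x * outside x) + (Σa² + Σnext)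
      ≡⟨ cong (_+ (Σa² + Σnext)) (∑offCore-* (D * D) (λ x → size x * outside x)) ⟨
    ∑[ x < n ] offCore x (D * D * (size x * outside x)) + (Σa² + Σnext)
      ≡⟨ +-assoc _ Σa² Σnext ⟨
    ∑[ x < n ] offCore x (D * D * (size x * outside x)) + Σa² + Σnext
      ≡⟨ cong (_+ Σnext) (∑offCore-+ _ _) ⟨
    ∑[ x < n ] offCore x (D * D * (size x * outside x) + (size x ∸ 1) * (a (j x) * a (j x))) + Σnext
      ≤⟨ +-monoˡ-≤ Σnext (∑offCore-mono-≤ step-ineq) ⟩
    ∑[ x < n ] offCore x (size x * F (lev x)) + Σnext
      ≡⟨ telescope F ⟩
    ∑[ x < n ] offCore x (size x * F (suc (lev x))) + Σtop
      ≤⟨ +-monoˡ-≤ Σtop (∑offCore-mono-≤ rounding-ineq) ⟩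
    ∑[ x < n ] offCore x ((size x ∸ 1) * (a (j x) * a (j x)) + (size x ∸ 1) * e + F (suc (lev x))) + Σtop
      ≡⟨ cong (_+ Σtop) (trans (∑offCore-+ _ _) (cong (_+ Σnext) (∑offCore-+ _ _))) ⟩
    Σa² + Σerr + Σnext + Σtop
      ≡⟨ rearrange Σa² Σerr Σnext Σtop ⟩
    Σerr + Σtop + (Σa² + Σnext)
      ≤⟨ +-monoˡ-≤ (Σa² + Σnext) (+-monoˡ-≤ Σtop Σerr≤n*[n*e]) ⟩
    n * (n * e) + Σtop + (Σa² + Σnext) ∎)
    where
    open ≤-Reasoning
    Σa² Σnext Σerr Σtop : ℕ
    Σa² = ∑[ x < n ] offCore x ((size x ∸ 1) * (a (j x) * a (j x)))
    Σnext = ∑[ x < n ] offCore x (F (suc (lev x)))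
    Σerr = ∑[ x < n ] offCore x ((size x ∸ 1) * e)
    Σtop = ∑[ x < n ] offCore x (F 1)
    rearrange : ∀ a e c t → a + e + c + t ≡ e + t + (a + c)
    rearrange = solve-∀
    Σerr≤n*[n*e] : Σerr ≤ n * (n * e)
    Σerr≤n*[n*e] = sum-≤-* (n * e) λ x → ≤-trans (offCore-≤ x _) (*-monoˡ-≤ e (≤-trans (m∸n≤m (size x) 1) (count≤n (x ≼_))))

module Wiener {n} (G : Graph n) (acyclic : ¬ HasCycle G)
              (dist : Fin n → Fin n → ℕ) (isDist : ∀ u v → IsDistance G u v (dist u v)) where
  open Distances G dist isDist

  errorCoeff : ℕ → ℕ
  errorCoeff ℓ = n * (n * (2 * (ℓ * (n ∸ 1))))

  n*[n*e]≡errorCoeff*D : ∀ ℓ D → n * (n * (2 * (D * (ℓ * (n ∸ 1))))) ≡ errorCoeff ℓ * D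
  n*[n*e]≡errorCoeff*D ℓ D = regroup n ℓ (n ∸ 1) D
    where
    regroup : ∀ n ℓ m D → n * (n * (2 * (D * (ℓ * m)))) ≡ n * (n * (2 * (ℓ * m))) * D
    regroup = solve-∀

  module CentralVertex (c : Fin n) where
    open BFS c public
    open Subtrees rooting public
    open Levels (λ x → dist x c) dist-pred public

    partition : ∀ x v → offCore x v + (if does (x ≟ᶠ c) then v else 0) ≡ v
    partition x v with x ≟ᶠ c
    ... | yes refl = cong (_+ v) (offCore-zero v (dist-refl x))
    ... | no x≢c   = trans (+-identityʳ _) (offCore-pos v (x≢c ∘ dist≡0⇒≡))

    ∑size*outside≡ : ∑[ z < n ] (size z * outside z) ≡ ∑[ z < n ] offCore z (size z * outside z)
    ∑size*outside≡ = begin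
      ∑[ z < n ] (size z * outside z)
        ≡⟨ sum-cong-≗ {n} (λ z → partition z _) ⟨
      ∑[ z < n ] (offCore z (size z * outside z) + (if does (z ≟ᶠ c) then size z * outside z else 0))
        ≡⟨ ∑-+-point _ c (λ z → size z * outside z) ⟩
      ∑[ z < n ] offCore z (size z * outside z) + size c * outside c
        ≡⟨ cong (∑[ z < n ] offCore z (size z * outside z) +_) (trans (cong (size c *_) outside-root) (*-zeroʳ (size c))) ⟩
      ∑[ z < n ] offCore z (size z * outside z) + 0
        ≡⟨ +-identityʳ _ ⟩
      ∑[ z < n ] offCore z (size z * outside z) ∎
      where open ≡-Reasoning

    offCoreCount≡n-1 : offCoreCount ≡ n ∸ 1
    offCoreCount≡n-1 = trans (sym (m+n∸n≡m offCoreCount 1)) (cong (_∸ 1) (begin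
      offCoreCount + 1                                              ≡⟨ ∑-+-point _ c (λ _ → 1) ⟨
      ∑[ z < n ] (offCore z 1 + (if does (z ≟ᶠ c) then 1 else 0))  ≡⟨ sum-cong-≗ {n} (λ z → partition z 1) ⟩
      ∑[ z < n ] 1                                                  ≡⟨ sum-one n ⟩
      n                                                             ∎))
      where open ≡-Reasoning

  scaled-even : ∀ ℓ → IsDiameter dist (2 * ℓ) → ∀ D →
                4 * (D * D * wiener dist) ≤ 4 * (errorCoeff ℓ * D) + 4 * ((n ∸ 1) * Approximants.h D n ℓ) + D * D * 0
  scaled-even ℓ diam D with center-even acyclic ℓ diam
  ... | c , bound = begin
    4 * (D * D * wiener dist)
      ≤⟨ *-monoʳ-≤ 4 (*-monoʳ-≤ (D * D) (wiener≤∑size*outside dist isDist)) ⟩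
    4 * (D * D * ∑[ z < n ] (size z * outside z))
      ≡⟨ cong (λ s → 4 * (D * D * s)) ∑size*outside≡ ⟩
    4 * (D * D * ∑[ z < n ] offCore z (size z * outside z))
      ≤⟨ *-monoʳ-≤ 4 scaled-bound ⟩
    4 * (n * (n * e) + ∑[ z < n ] offCore z (h ℓ))
      ≡⟨ cong (4 *_) (cong₂ _+_ (n*[n*e]≡errorCoeff*D ℓ D) (trans (∑offCore-const (h ℓ)) (cong (_* h ℓ) offCoreCount≡n-1))) ⟩
    4 * (errorCoeff ℓ * D + (n ∸ 1) * h ℓ)
      ≡⟨ expand (errorCoeff ℓ * D) ((n ∸ 1) * h ℓ) (D * D) ⟩
    4 * (errorCoeff ℓ * D) + 4 * ((n ∸ 1) * h ℓ) + D * D * 0 ∎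
    where
    open CentralVertex c
    open ScaledBound rooting (λ x → dist x c) dist-pred ℓ bound D
    open Approximants D n
    open ≤-Reasoning
    expand : ∀ a b d → 4 * (a + b) ≡ 4 * a + 4 * b + d * 0
    expand = solve-∀

  module CentralEdge (c₁ c₂ : Fin n) (c₂~c₁ : Adj G c₂ c₁) where
    open BFS c₁ public

    c₂≢c₁ : c₂ ≢ c₁
    c₂≢c₁ = Adj-irrefl c₂~c₁

    dist-c₂-c₁ : dist c₂ c₁ ≡ 1
    dist-c₂-c₁ = ≤-antisym (dist-minimal (cons c₂~c₁ nil)) (n≢0⇒n>0 (c₂≢c₁ ∘ dist≡0⇒≡))

    bfsParent-c₂ : bfsParent c₂ ≡ c₁
    bfsParent-c₂ = dist≡0⇒≡ (suc-injective (trans (dist-bfsParent c₂≢c₁) dist-c₂-c₁))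

    -- the distance from x to the nearer of c₁ and c₂
    lev : Fin n → ℕ
    lev x = dist x c₁ ∸ ⟦ c₂ ≼ x ⟧

    lev-cases : ∀ x → (c₂ ≼ x ≡ true × lev x ≡ dist x c₂)
                    ⊎ (c₂ ≼ x ≡ false × lev x ≡ dist x c₁ × suc (dist x c₁) ≡ dist x c₂)
    lev-cases x with c₂ ≼ x in c₂≼x
    ... | true  = inj₁ (refl , sym (begin
      dist x c₂               ≡⟨ trans (dist≡treeDist acyclic x c₂) (treeDist-sym x c₂) ⟩
      treeDist c₂ x           ≡⟨ treeDist-ancestor c₂≼x ⟩
      dist x c₁ ∸ dist c₂ c₁  ≡⟨ cong (dist x c₁ ∸_) dist-c₂-c₁ ⟩
      dist x c₁ ∸ 1           ∎))
      where open ≡-Reasoning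
    ... | false = inj₂ (refl , refl , sym (begin
      dist x c₂                        ≡⟨ trans (dist≡treeDist acyclic x c₂) (treeDist-sym x c₂) ⟩
      treeDist c₂ x                    ≡⟨ treeDist-parent c₂≼x ⟩
      suc (treeDist (bfsParent c₂) x)  ≡⟨ cong (λ y → suc (treeDist y x)) bfsParent-c₂ ⟩
      suc (treeDist c₁ x)              ≡⟨ cong suc (trans (treeDist-sym c₁ x) (sym (dist≡treeDist acyclic x c₁))) ⟩
      suc (dist x c₁)                  ∎))
      where open ≡-Reasoning

    lev-c₁ : lev c₁ ≡ 0
    lev-c₁ = subst (λ d → d ∸ ⟦ c₂ ≼ c₁ ⟧ ≡ 0) (sym (dist-refl c₁)) (0∸n≡0 ⟦ c₂ ≼ c₁ ⟧)

    lev-c₂ : lev c₂ ≡ 0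
    lev-c₂ = cong₂ _∸_ dist-c₂-c₁ (cong ⟦_⟧ (≼-refl c₂))

    lev≢0 : ∀ {x} → x ≢ c₁ → x ≢ c₂ → lev x ≢ 0
    lev≢0 {x} x≢c₁ x≢c₂ lx≡0 with lev-cases x
    ... | inj₁ (_ , lx≡)     = x≢c₂ (dist≡0⇒≡ (trans (sym lx≡) lx≡0))
    ... | inj₂ (_ , lx≡ , _) = x≢c₁ (dist≡0⇒≡ (trans (sym lx≡) lx≡0))

    lev-parent : ∀ x → pred (lev x) ≡ lev (bfsParent x)
    lev-parent x = by-cases (x ≟ᶠ c₁) (x ≟ᶠ c₂)
      where
      by-cases : Dec (x ≡ c₁) → Dec (x ≡ c₂) → pred (lev x) ≡ lev (bfsParent x)
      by-cases (yes x≡c₁) _ = subst (λ y → pred (lev y) ≡ lev (bfsParent y)) (sym x≡c₁)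
        (trans (cong pred lev-c₁) (sym (trans (cong lev bfsParent-c) lev-c₁)))
      by-cases (no _) (yes x≡c₂) = subst (λ y → pred (lev y) ≡ lev (bfsParent y)) (sym x≡c₂)
        (trans (cong pred lev-c₂) (sym (trans (cong lev bfsParent-c₂) lev-c₁)))
      by-cases (no x≢c₁) (no x≢c₂)
        rewrite ≼-unfold-≢ {c₂} x≢c₁ (x≢c₂ ∘ sym) | sym (dist-bfsParent x≢c₁) with c₂ ≼ bfsParent x
      ... | true  = refl
      ... | false = refl

    lev≤ : ∀ {ℓ} → (∀ x → dist x c₁ ≤ ℓ ⊎ dist x c₂ ≤ ℓ) → ∀ x → lev x ≤ ℓ
    lev≤ bound x with bound x | lev-cases x
    ... | inj₁ xc₁≤ℓ | _ = ≤-trans (m∸n≤m (dist x c₁) ⟦ c₂ ≼ x ⟧) xc₁≤ℓ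
    ... | inj₂ xc₂≤ℓ | inj₁ (_ , lx≡) = ≤-trans (≤-reflexive lx≡) xc₂≤ℓ
    ... | inj₂ xc₂≤ℓ | inj₂ (_ , lx≡ , 1+xc₁≡xc₂) =
      ≤-trans (≤-reflexive lx≡) (≤-trans (n≤1+n _) (≤-trans (≤-reflexive 1+xc₁≡xc₂) xc₂≤ℓ))

    open Subtrees rooting public
    open Levels lev lev-parent public

    partition : ∀ x v → offCore x v + (if does (x ≟ᶠ c₁) then v else 0) + (if does (x ≟ᶠ c₂) then v else 0) ≡ v
    partition x v with x ≟ᶠ c₁ | x ≟ᶠ c₂
    ... | yes refl | yes c₁≡c₂ = ⊥-elim (c₂≢c₁ (sym c₁≡c₂))
    ... | yes refl | no _      rewrite offCore-zero v lev-c₁ = +-identityʳ v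
    ... | no _     | yes refl  rewrite offCore-zero v lev-c₂ = refl
    ... | no x≢c₁  | no x≢c₂   rewrite offCore-pos v (lev≢0 x≢c₁ x≢c₂) = trans (+-identityʳ _) (+-identityʳ v)

    ∑size*outside≡ : ∑[ z < n ] (size z * outside z) ≡ ∑[ z < n ] offCore z (size z * outside z) + size c₂ * outside c₂
    ∑size*outside≡ = begin
      ∑[ z < n ] φ z
        ≡⟨ sum-cong-≗ {n} (λ z → partition z _) ⟨
      ∑[ z < n ] (offCore z (φ z) + (if does (z ≟ᶠ c₁) then φ z else 0) + (if does (z ≟ᶠ c₂) then φ z else 0))
        ≡⟨ ∑-+-point _ c₂ φ ⟩
      ∑[ z < n ] (offCore z (φ z) + (if does (z ≟ᶠ c₁) then φ z else 0)) + φ c₂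
        ≡⟨ cong (_+ φ c₂) (∑-+-point _ c₁ φ) ⟩
      ∑[ z < n ] offCore z (φ z) + φ c₁ + φ c₂
        ≡⟨ cong (λ t → ∑[ z < n ] offCore z (φ z) + t + φ c₂) (trans (cong (size c₁ *_) outside-root) (*-zeroʳ (size c₁))) ⟩
      ∑[ z < n ] offCore z (φ z) + 0 + φ c₂
        ≡⟨ cong (_+ φ c₂) (+-identityʳ _) ⟩
      ∑[ z < n ] offCore z (φ z) + φ c₂ ∎
      where
      open ≡-Reasoning
      φ : Fin n → ℕ
      φ z = size z * outside z

    offCoreCount≡n-2 : offCoreCount ≡ n ∸ 2
    offCoreCount≡n-2 = trans (sym (m+n∸n≡m offCoreCount 2)) (cong (_∸ 2) (begin
      offCoreCount + 2      ≡⟨ +-assoc offCoreCount 1 1 ⟨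
      offCoreCount + 1 + 1  ≡⟨ cong (_+ 1) (∑-+-point _ c₁ (λ _ → 1)) ⟨
      ∑[ z < n ] (offCore z 1 + (if does (z ≟ᶠ c₁) then 1 else 0)) + 1
        ≡⟨ ∑-+-point _ c₂ (λ _ → 1) ⟨
      ∑[ z < n ] (offCore z 1 + (if does (z ≟ᶠ c₁) then 1 else 0) + (if does (z ≟ᶠ c₂) then 1 else 0))
        ≡⟨ sum-cong-≗ {n} (λ z → partition z 1) ⟩
      ∑[ z < n ] 1          ≡⟨ sum-one n ⟩
      n                     ∎))
      where open ≡-Reasoning

    4*size*outside≤n² : 4 * (size c₂ * outside c₂) ≤ n * n
    4*size*outside≤n² = subst (λ m → 4 * (size c₂ * outside c₂) ≤ m * m) (count+count-not (c₂ ≼_))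
                              (4xy≤[x+y]² (size c₂) (outside c₂))

  scaled-odd : ∀ ℓ → IsDiameter dist (2 * ℓ + 1) → ∀ D →
               4 * (D * D * wiener dist) ≤ 4 * (errorCoeff ℓ * D) + 4 * ((n ∸ 2) * Approximants.h D n ℓ) + D * D * (n * n)
  scaled-odd ℓ diam D with center-odd acyclic ℓ diam
  ... | c₁ , c₂ , c₂~c₁ , bound = begin
    4 * (D * D * wiener dist)
      ≤⟨ *-monoʳ-≤ 4 (*-monoʳ-≤ (D * D) (wiener≤∑size*outside dist isDist)) ⟩
    4 * (D * D * ∑[ z < n ] (size z * outside z))
      ≡⟨ cong (λ s → 4 * (D * D * s)) ∑size*outside≡ ⟩
    4 * (D * D * (Σoff + size c₂ * outside c₂))
      ≡⟨ distribute (D * D) Σoff (size c₂ * outside c₂) ⟩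
    4 * (D * D * Σoff) + D * D * (4 * (size c₂ * outside c₂))
      ≤⟨ +-mono-≤ (*-monoʳ-≤ 4 scaled-bound) (*-monoʳ-≤ (D * D) 4*size*outside≤n²) ⟩
    4 * (n * (n * e) + ∑[ z < n ] offCore z (h ℓ)) + D * D * (n * n)
      ≡⟨ cong (λ s → 4 * s + D * D * (n * n))
              (cong₂ _+_ (n*[n*e]≡errorCoeff*D ℓ D) (trans (∑offCore-const (h ℓ)) (cong (_* h ℓ) offCoreCount≡n-2))) ⟩
    4 * (errorCoeff ℓ * D + (n ∸ 2) * h ℓ) + D * D * (n * n)
      ≡⟨ cong (_+ D * D * (n * n)) (*-distribˡ-+ 4 (errorCoeff ℓ * D) _) ⟩
    4 * (errorCoeff ℓ * D) + 4 * ((n ∸ 2) * h ℓ) + D * D * (n * n) ∎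
    where
    open CentralEdge c₁ c₂ c₂~c₁
    open ScaledBound rooting lev lev-parent ℓ (lev≤ bound) D
    open Approximants D n
    open ≤-Reasoning
    Σoff : ℕ
    Σoff = ∑[ z < n ] offCore z (size z * outside z)
    distribute : ∀ d s p → 4 * (d * (s + p)) ≡ 4 * (d * s) + d * (4 * p)
    distribute = solve-∀

open RationalBounds using (module Rescaled)
open import Data.Integer using (+_)
open import Data.Rational using (_/_; ↧ₙ_)

module _ (k n : ℕ) where
  open Rescaled k
  open Approximants (suc k) n

  LeG-approximant : 1 ≤ n ∸ 1 → ∀ j → LeG (suc j) n (h (suc j) /D²)
  LeG-approximant 1≤n-1 zero    = LeG-base (≤-trans 1≤n-1 (m∸n≤m n 1))
  LeG-approximant 1≤n-1 (suc j) =
    LeG-step (≤-trans 1≤n-1 (m∸n≤m n 1)) (D≤a 1≤n-1 j) (⌊√⌋²≤ (h (suc j))) (LeG-approximant 1≤n-1 j)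

-- For every ε > 0 the scale D = C ↧ε + 1 makes the rounding error C / D at most ε.
affine-bound : ∀ {n ℓ W} m q C → 1 ≤ n ∸ 1 →
               (∀ D → 4 * (D * D * W) ≤ 4 * (C * D) + 4 * (m * Approximants.h D n (suc ℓ)) + D * D * q) →
               LeAffG (ℕ→ℚ m) ((+ q) / 4) (suc ℓ) n (ℕ→ℚ W)
affine-bound {n} {ℓ} {W} m q C 1≤n-1 scaled ε ε>0 =
  h (suc ℓ) /D² , LeG-approximant k n 1≤n-1 ℓ , rescale W C m (h (suc ℓ)) q ε ε>0 (n≤1+n _) (scaled D)
  where
  k : ℕ
  k = C * ↧ₙ ε
  open Rescaled k
  open Approximants D n

theorem4p6 : (n : ℕ) (T : Graph n) → IsTree T →
    (dist : Fin n → Fin n → ℕ) → (∀ u v → IsDistance T u v (dist u v)) →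
    (d : ℕ) → IsDiameter dist d → 2 ≤ d →
    ((ℓ : ℕ) → d ≡ 2 * ℓ →
      LeAffG (ℕ→ℚ (n ∸ 1)) (ℕ→ℚ 0) ℓ n (ℕ→ℚ (wiener dist)))
    × ((ℓ : ℕ) → d ≡ 2 * ℓ + 1 →
      LeAffG (ℕ→ℚ (n ∸ 2)) ((+ (n * n)) / 4) ℓ n (ℕ→ℚ (wiener dist)))
theorem4p6 n T (_ , acyclic) dist isDist d diameter@((u , v , uv≡d) , _) 2≤d = even , odd
  where
  open Distances T dist isDist using (dist-refl)
  open Wiener T acyclic dist isDist
  1≤n-1 : 1 ≤ n ∸ 1
  1≤n-1 = ∸-monoˡ-≤ 1 (distinct⇒2≤n u≢v)
    where
    u≢v : u ≢ v
    u≢v refl with () ← subst (2 ≤_) (trans (sym uv≡d) (dist-refl u)) 2≤d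
  even : (ℓ : ℕ) → d ≡ 2 * ℓ → LeAffG (ℕ→ℚ (n ∸ 1)) (ℕ→ℚ 0) ℓ n (ℕ→ℚ (wiener dist))
  even zero    d≡0 with () ← subst (2 ≤_) d≡0 2≤d
  -- (+ 0) / 4 reduces to ℕ→ℚ 0
  even (suc ℓ) d≡2ℓ =
    affine-bound (n ∸ 1) 0 (errorCoeff (suc ℓ)) 1≤n-1 (scaled-even (suc ℓ) (subst (IsDiameter dist) d≡2ℓ diameter))
  odd : (ℓ : ℕ) → d ≡ 2 * ℓ + 1 → LeAffG (ℕ→ℚ (n ∸ 2)) ((+ (n * n)) / 4) ℓ n (ℕ→ℚ (wiener dist))
  odd zero    d≡1 with s≤s () ← subst (2 ≤_) d≡1 2≤d
  odd (suc ℓ) d≡2ℓ+1 =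
    affine-bound (n ∸ 2) (n * n) (errorCoeff (suc ℓ)) 1≤n-1 (scaled-odd (suc ℓ) (subst (IsDiameter dist) d≡2ℓ+1 diameter))
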